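{- Let $n\ge 2$ and let $D\subseteq\{d : d\mid n,\ 1\le d<n\}$ be such that $4\nmid n/d$ for every $d\in D$. Let $\lambda_j=\sum_{d\in D}c(j,n/d)$, $0\le j\le n-1$, be the eigenvalues of $\mathrm{ICG}_n(D)$. Then $\lambda_j$ is even for every odd $j$ with $0\le j\le n-1$ if and only if $D=D_1\cup 2D_1$, where $D_1=\{d\in D : n/d\equiv 2\pmod 4\}$ and $2D_1=\{2d : d\in D_1\}$.
   Context: $\mathrm{ICG}_n(D)$ is the graph on $\mathbb{Z}_n=\{0,\dots,n-1\}$ where $a,b$ are adjacent iff $\gcd(a-b,n)\in D$. The Ramanujan function is $c(j,m)=\mu(t_{m,j})\,\varphi(m)/\varphi(t_{m,j})$ with $t_{m,j}=m/\gcd(m,j)$ ($\gcd(m,0)=m$), $\mu$ the Möbius function and $\varphi$ Euler's function; the $\lambda_j$ are exactly the adjacency eigenvalues. -}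

module Defs where

open import Data.Nat using (ℕ; zero; suc; _+_; _*_; _≤_; _<_; _≡ᵇ_)
open import Data.Nat.DivMod using (_/_; _%_)
open import Data.Nat.GCD using (gcd)
open import Data.Nat.Divisibility using (_∣_; _∣?_)
open import Data.Nat.Primality using (prime?)
open import Data.List using (List; []; _∷_; upTo; filter; length; map; sum; foldr)
open import Data.Integer as ℤ using (ℤ; +_)
open import Data.Product using (_×_; Σ; ∃; _,_)
open import Data.Sum using (_⊎_)
open import Data.List.Membership.Propositional using (_∈_)
open import Relation.Binary.PropositionalEquality using (_≡_)
open import Relation.Nullary.Decidable using (Dec; does; ¬?)
open import Data.Bool using (Bool; true; false; if_then_else_)

-- truncated division with the convention  m ÷ 0 = 0 (only ever used with
-- nonzero exact divisors)
_÷_ : ℕ → ℕ → ℕ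
m ÷ zero = zero
m ÷ suc k = m / suc k

φ : ℕ → ℕ
φ m = length (filter (λ k → (gcd (suc k) m) Data.Nat.≟ 1) (upTo m))

ω : ℕ → ℕ
ω m = length (filter (λ p → p ∣? m) (filter prime? (upTo (suc m))))

squarefree : ℕ → Bool
squarefree m = foldr (λ b acc → if b then acc else false) true
  (map (λ d → does (¬? ((suc (suc d) * suc (suc d)) ∣? m))) (upTo m))

μ : ℕ → ℤ
μ m = if squarefree m then (ℤ.- (+ 1)) ℤ.^ ω m else + 0

-- t_{m,j} = m / gcd(m,j)   (stdlib: gcd m 0 = m)
t : ℕ → ℕ → ℕ
t m j = m ÷ gcd m j

-- Ramanujan function c(j,m) = μ(t) φ(m)/φ(t)
c : ℕ → ℕ → ℤ
c j m = μ (t m j) ℤ.* (+ (φ m ÷ φ (t m j)))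

eigen : ℕ → List ℕ → ℕ → ℤ
eigen n D j = sum′ (map (λ d → c j (n ÷ d)) D)
  where
  sum′ : List ℤ → ℤ
  sum′ [] = + 0
  sum′ (x ∷ xs) = x ℤ.+ sum′ xs

InD₁ : ℕ → List ℕ → ℕ → Set
InD₁ n D d = d ∈ D × (n ÷ d) % 4 ≡ 2

InD₁∪2D₁ : ℕ → List ℕ → ℕ → Set
InD₁∪2D₁ n D x = InD₁ n D x ⊎ ∃ (λ d → InD₁ n D d × x ≡ 2 * d)

-- For odd j, c(j, m) is odd exactly when t = m / gcd(m, j) is square-free and every prime
-- factor of m divides t: then φ(m)/φ(t) = gcd(m, j) is odd, and otherwise the part of m prime
-- to t is odd and > 1 and contributes its even totient. Hence c(j, 2o) ≡ c(j, o) (mod 2) for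
-- odd o, so modulo 2 the term of d ∈ D depends only on the odd part of n/d, which d shares with
-- its partner: 2d if n/d ≡ 2 (mod 4), and d/2 if n/d is odd. D = D₁ ∪ 2D₁ says precisely that
-- D is closed under partners, and then the odd terms of λ_j cancel in pairs. Conversely, take
-- an unpaired d ∈ D whose odd part o is least, let r be the radical of o and m₂ the part of n
-- prime to 2o; for j = (o / r) m₂ the odd divisors o′ of n with c(j, o′) odd all divide o, so
-- by the minimality of o the term of d is the only one that does not cancel, and λ_j is odd.

module Submission where

open import Data.Bool using (Bool; true; false; not; if_then_else_)
open import Data.Empty using (⊥-elim)
open import Data.Integer as ℤ using (ℤ; +_; -[1+_]; _⊖_)
open import Data.Integer.Divisibility using () renaming (_∣_ to _∣ℤ_)
open import Data.List using (List; []; _∷_; applyUpTo; upTo; map; filter; foldr; length)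
open import Data.List.Membership.Propositional using (_∈_; _∉_)
open import Data.List.Membership.Propositional.Properties using (∈-map⁺; ∈-map⁻; ∈-upTo⁺; ∈-filter⁺; ∈-filter⁻)
open import Data.List.Relation.Unary.Any as Any using (here; there)
open import Data.List.Relation.Unary.All as All using (All)
open import Data.List.Relation.Unary.AllPairs using (_∷_)
open import Data.List.Relation.Unary.Unique.Propositional using (Unique)
import Data.List.Relation.Unary.Unique.Propositional.Properties as Unique
open import Data.List.Properties using (filter-all; filter-reject; filter-accept; filter-notAll)
open import Data.List.Extrema.Nat using (argmin; argmin-all; f[argmin]≤f[xs])
open import Data.Integer.Properties using (abs-*; [1+m]⊖[1+n]≡m⊖n)
open import Data.Nat
open import Data.Nat.Coprimality
  using (Coprime; coprime?; coprime-divisor; coprime-/gcd; 1-coprimeTo; gcd≡1⇒coprime; coprime⇒gcd≡1) renaming (sym to coprime-sym)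
open import Data.Nat.DivMod using (_/_; _%_; m≡m%n+[m/n]*n; [m+kn]%n≡m%n; m%n<n; m*n/n≡m; m/n*n≡m)
open import Data.Nat.Divisibility
open import Data.Nat.Divisibility using (%-presˡ-∣; ∣n∣m%n⇒∣m)
open import Data.Nat.GCD using (gcd; gcd[m,n]∣m; gcd[m,n]∣n; gcd-greatest; c*gcd[m,n]≡gcd[cm,cn])
open import Data.Nat.Primality using (irreducible[2])
open import Data.Nat.Properties
open import Data.List.Membership.DecPropositional Data.Nat._≟_ using (_∈?_)
open import Data.Nat.Solver using (module +-*-Solver)
open import Data.Parity.Base as ℙ using (Parity; 0ℙ; 1ℙ)
import Data.Parity.Properties as ℙ
open import Data.Product using (∃; _×_; _,_; proj₁; proj₂)
open import Data.Sum using (_⊎_; inj₁; inj₂)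
open import Function using (_∘_; id; case_of_)
open import Function.Bundles using (_⇔_; mk⇔; Equivalence)
import Function.Properties.Equivalence as ⇔
open import Data.Product.Function.NonDependent.Propositional using (_×-⇔_)
open import Relation.Binary.Definitions using (DecidableEquality)
open import Relation.Binary.PropositionalEquality
open import Relation.Nullary using (¬_; Dec; yes; no)
open import Relation.Nullary.Decidable using (does; ¬?; dec-true; dec-false; decidable-stable)
open import Relation.Unary using (Decidable)
open import Induction.WellFounded using (Acc; acc)
open import Data.Nat.Induction using (<-wellFounded)

open import Defs

open ≡-Reasoning
open +-*-Solver using (solve; _:+_; _:*_; con; _:=_)

Odd : ℕ → Set
Odd n = parity n ≡ 1ℙ

parity≡0ℙ⇒2∣ : ∀ n → parity n ≡ 0ℙ → 2 ∣ n
parity≡0ℙ⇒2∣ zero _ = divides 0 refl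
parity≡0ℙ⇒2∣ (suc (suc n)) p = ∣m∣n⇒∣m+n (∣-refl {2}) (parity≡0ℙ⇒2∣ n p)

2∣⇒parity≡0ℙ : ∀ {n} → 2 ∣ n → parity n ≡ 0ℙ
2∣⇒parity≡0ℙ (divides q refl) = trans (ℙ.*-homo-* q 2) (ℙ.*-zeroʳ (parity q))

parity[2*n] : ∀ n → parity (2 * n) ≡ 0ℙ
parity[2*n] n = ℙ.*-homo-* 2 n

odd⇒¬2∣ : ∀ {n} → Odd n → ¬ 2 ∣ n
odd⇒¬2∣ odd 2∣n with () ← trans (sym odd) (2∣⇒parity≡0ℙ 2∣n)

¬2∣⇒odd : ∀ n → ¬ 2 ∣ n → Odd n
¬2∣⇒odd n ¬2∣n with parity n in p
... | 1ℙ = refl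
... | 0ℙ = ⊥-elim (¬2∣n (parity≡0ℙ⇒2∣ n p))

odd-∣ : ∀ {d m} → d ∣ m → Odd m → Odd d
odd-∣ {d} d∣m odd = ¬2∣⇒odd d (λ 2∣d → odd⇒¬2∣ odd (∣-trans 2∣d d∣m))

odd-* : ∀ {m n} → Odd m → Odd n → Odd (m * n)
odd-* {m} {n} oddm oddn = trans (ℙ.*-homo-* m n) (cong₂ ℙ._*_ oddm oddn)

odd⇒1≤ : ∀ {n} → Odd n → 1 ≤ n
odd⇒1≤ {suc _} _ = s≤s z≤n

odd⇒≡1+2h : ∀ n → Odd n → ∃ λ h → n ≡ suc (h + h)
odd⇒≡1+2h (suc zero) _ = 0 , refl
odd⇒≡1+2h (suc (suc n)) odd with odd⇒≡1+2h n odd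
... | h , refl = suc h , cong (suc ∘ suc) (sym (+-suc h h))

odd⇒coprime-2 : ∀ {m} → Odd m → Coprime 2 m
odd⇒coprime-2 odd (d∣2 , d∣m) with irreducible[2] d∣2
... | inj₁ d≡1 = d≡1
... | inj₂ refl = ⊥-elim (odd⇒¬2∣ odd d∣m)

%2≡1⇔odd : ∀ n → n % 2 ≡ 1 ⇔ Odd n
%2≡1⇔odd zero = mk⇔ (λ ()) (λ ())
%2≡1⇔odd (suc zero) = mk⇔ (λ _ → refl) (λ _ → refl)
%2≡1⇔odd (suc (suc n)) = %2≡1⇔odd n

2*odd%4≡2 : ∀ o → Odd o → (2 * o) % 4 ≡ 2
2*odd%4≡2 o odd with odd⇒≡1+2h o odd
... | h , refl = trans (cong (_% 4) 2[1+2h]≡2+4h) ([m+kn]%n≡m%n 2 h 4)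
  where
  2[1+2h]≡2+4h : 2 * suc (h + h) ≡ 2 + h * 4
  2[1+2h]≡2+4h = solve 1 (λ h → con 2 :* (con 1 :+ (h :+ h)) := con 2 :+ h :* con 4) refl h

%4≡2⇒parity≡0ℙ : ∀ q → q % 4 ≡ 2 → parity q ≡ 0ℙ
%4≡2⇒parity≡0ℙ q q%4≡2 = 2∣⇒parity≡0ℙ (divides (1 + (q / 4) * 2) (begin
  q                       ≡⟨ m≡m%n+[m/n]*n q 4 ⟩
  q % 4 + (q / 4) * 4     ≡⟨ cong (_+ (q / 4) * 4) q%4≡2 ⟩
  2 + (q / 4) * 4         ≡⟨ solve 1 (λ x → con 2 :+ x :* con 4 := (con 1 :+ x :* con 2) :* con 2) refl (q / 4) ⟩
  (1 + (q / 4) * 2) * 2   ∎))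

parityℤ : ℤ → Parity
parityℤ x = parity ℤ.∣ x ∣

parity-suc-+-suc : ∀ m n → parity (suc m) ℙ.+ parity (suc n) ≡ parity (m + n)
parity-suc-+-suc m n = begin
  parity (suc m) ℙ.+ parity (suc n) ≡⟨ ℙ.+-homo-+ (suc m) (suc n) ⟨
  parity (suc m + suc n)            ≡⟨ cong (parity ∘ suc) (+-suc m n) ⟩
  parity (m + n)                    ∎

parity-⊖ : ∀ m n → parityℤ (m ⊖ n) ≡ parity m ℙ.+ parity n
parity-⊖ zero zero = refl
parity-⊖ zero (suc n) = refl
parity-⊖ (suc m) zero = sym (ℙ.+-identityʳ (parity (suc m)))
parity-⊖ (suc m) (suc n) = begin
  parityℤ (suc m ⊖ suc n)           ≡⟨ cong parityℤ ([1+m]⊖[1+n]≡m⊖n m n) ⟩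
  parityℤ (m ⊖ n)                   ≡⟨ parity-⊖ m n ⟩
  parity m ℙ.+ parity n             ≡⟨ ℙ.+-homo-+ m n ⟨
  parity (m + n)                    ≡⟨ parity-suc-+-suc m n ⟨
  parity (suc m) ℙ.+ parity (suc n) ∎

parityℤ-+ : ∀ x y → parityℤ (x ℤ.+ y) ≡ parityℤ x ℙ.+ parityℤ y
parityℤ-+ (+ m) (+ n) = ℙ.+-homo-+ m n
parityℤ-+ (+ m) -[1+ n ] = parity-⊖ m (suc n)
parityℤ-+ -[1+ m ] (+ n) = trans (parity-⊖ n (suc m)) (ℙ.+-comm (parity n) (parity (suc m)))
parityℤ-+ -[1+ m ] -[1+ n ] = sym (parity-suc-+-suc m n)

parityℤ-* : ∀ x y → parityℤ (x ℤ.* y) ≡ parityℤ x ℙ.* parityℤ y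
parityℤ-* x y = trans (cong parity (abs-* x y)) (ℙ.*-homo-* ℤ.∣ x ∣ ℤ.∣ y ∣)

parityℤ-[-1]^ : ∀ k → parityℤ ((ℤ.- (+ 1)) ℤ.^ k) ≡ 1ℙ
parityℤ-[-1]^ zero = refl
parityℤ-[-1]^ (suc k) = trans (parityℤ-* (ℤ.- (+ 1)) ((ℤ.- (+ 1)) ℤ.^ k)) (parityℤ-[-1]^ k)

*≡1ℙ⇔ : ∀ p q → p ℙ.* q ≡ 1ℙ ⇔ (p ≡ 1ℙ × q ≡ 1ℙ)
*≡1ℙ⇔ 0ℙ q = mk⇔ (λ ()) (λ ())
*≡1ℙ⇔ 1ℙ q = mk⇔ (refl ,_) proj₂

≡1ℙ⇔⇒≡ : ∀ {p q} → (p ≡ 1ℙ ⇔ q ≡ 1ℙ) → p ≡ q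
≡1ℙ⇔⇒≡ {0ℙ} {0ℙ} _ = refl
≡1ℙ⇔⇒≡ {0ℙ} {1ℙ} p⇔q = Equivalence.from p⇔q refl
≡1ℙ⇔⇒≡ {1ℙ} {0ℙ} p⇔q = sym (Equivalence.to p⇔q refl)
≡1ℙ⇔⇒≡ {1ℙ} {1ℙ} _ = refl

-- Finite sums and their reindexing

Σ< : ℕ → (ℕ → ℕ) → ℕ
Σ< zero f = 0
Σ< (suc n) f = Σ< n f + f n

Σ<-cong : ∀ n {f g : ℕ → ℕ} → (∀ i → i < n → f i ≡ g i) → Σ< n f ≡ Σ< n g
Σ<-cong zero _ = refl
Σ<-cong (suc n) f≗g = cong₂ _+_ (Σ<-cong n (λ i i<n → f≗g i (m<n⇒m<1+n i<n))) (f≗g n ≤-refl)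

Σ<-const : ∀ n c → Σ< n (λ _ → c) ≡ n * c
Σ<-const zero c = refl
Σ<-const (suc n) c = trans (cong (_+ c) (Σ<-const n c)) (+-comm (n * c) c)

Σ<-zero : ∀ n (f : ℕ → ℕ) → (∀ i → i < n → f i ≡ 0) → Σ< n f ≡ 0
Σ<-zero n f f≗0 = trans (Σ<-cong n f≗0) (trans (Σ<-const n 0) (*-zeroʳ n))

Σ<-+ : ∀ n (f g : ℕ → ℕ) → Σ< n (λ i → f i + g i) ≡ Σ< n f + Σ< n g
Σ<-+ zero f g = refl
Σ<-+ (suc n) f g = trans (cong (_+ (f n + g n)) (Σ<-+ n f g)) (solve 4
  (λ a b c d → (a :+ b) :+ (c :+ d) := (a :+ c) :+ (b :+ d)) refl (Σ< n f) (Σ< n g) (f n) (g n))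

Σ<-*ʳ : ∀ n (f : ℕ → ℕ) c → Σ< n (λ i → f i * c) ≡ Σ< n f * c
Σ<-*ʳ zero f c = refl
Σ<-*ʳ (suc n) f c = trans (cong (_+ f n * c) (Σ<-*ʳ n f c)) (sym (*-distribʳ-+ c (Σ< n f) (f n)))

Σ<-split : ∀ a b (f : ℕ → ℕ) → Σ< (a + b) f ≡ Σ< a f + Σ< b (λ i → f (a + i))
Σ<-split a zero f = trans (cong (λ x → Σ< x f) (+-identityʳ a)) (sym (+-identityʳ _))
Σ<-split a (suc b) f = begin
  Σ< (a + suc b) f                               ≡⟨ cong (λ x → Σ< x f) (+-suc a b) ⟩
  Σ< (a + b) f + f (a + b)                       ≡⟨ cong (_+ f (a + b)) (Σ<-split a b f) ⟩
  (Σ< a f + Σ< b (λ i → f (a + i))) + f (a + b)  ≡⟨ +-assoc (Σ< a f) _ _ ⟩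
  Σ< a f + Σ< (suc b) (λ i → f (a + i))          ∎

Σ<-suc : ∀ n (f : ℕ → ℕ) → Σ< (suc n) f ≡ f 0 + Σ< n (f ∘ suc)
Σ<-suc n f = Σ<-split 1 n f

Σ<-swap : ∀ b a (g : ℕ → ℕ → ℕ) → Σ< b (λ i → Σ< a (λ u → g u i)) ≡ Σ< a (λ u → Σ< b (g u))
Σ<-swap zero a g = sym (Σ<-zero a (λ _ → 0) (λ _ _ → refl))
Σ<-swap (suc b) a g = trans (cong (_+ Σ< a (λ u → g u b)) (Σ<-swap b a g))
  (sym (Σ<-+ a (λ u → Σ< b (g u)) (λ u → g u b)))

Σ<-blocks : ∀ b a (f : ℕ → ℕ) → Σ< (b * a) f ≡ Σ< b (λ i → Σ< a (λ u → f (i * a + u)))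
Σ<-blocks zero a f = refl
Σ<-blocks (suc b) a f = begin
  Σ< (a + b * a) f                            ≡⟨ cong (λ x → Σ< x f) (+-comm a (b * a)) ⟩
  Σ< (b * a + a) f                            ≡⟨ Σ<-split (b * a) a f ⟩
  Σ< (b * a) f + Σ< a (λ u → f (b * a + u))   ≡⟨ cong (_+ Σ< a (λ u → f (b * a + u))) (Σ<-blocks b a f) ⟩
  Σ< (suc b) (λ i → Σ< a (λ u → f (i * a + u))) ∎

Σ<-reverse : ∀ n (f : ℕ → ℕ) → Σ< n (λ i → f (n ∸ suc i)) ≡ Σ< n f
Σ<-reverse zero f = refl
Σ<-reverse (suc n) f = begin
  Σ< (suc n) (λ i → f (suc n ∸ suc i)) ≡⟨ Σ<-suc n (λ i → f (n ∸ i)) ⟩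
  f n + Σ< n (λ i → f (n ∸ suc i))     ≡⟨ cong₂ _+_ refl (Σ<-reverse n f) ⟩
  f n + Σ< n f                         ≡⟨ +-comm (f n) (Σ< n f) ⟩
  Σ< (suc n) f                         ∎

Σ<-term : ∀ n (f : ℕ → ℕ) i → i < n → f i ≤ Σ< n f
Σ<-term (suc n) f i i<1+n with i ≟ n
... | yes refl = m≤n+m (f i) (Σ< n f)
... | no i≢n = ≤-trans (Σ<-term n f i (≤∧≢⇒< (≤-pred i<1+n) i≢n)) (m≤m+n (Σ< n f) (f n))

Σ<-change : ∀ n (g h : ℕ → ℕ) k → k < n → (∀ i → i < n → i ≢ k → g i ≡ h i) →
  Σ< n g + h k ≡ Σ< n h + g k
Σ<-change (suc n) g h k k<1+n g≗h with n ≟ k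
... | yes refl = begin
  Σ< n g + g n + h n  ≡⟨ cong (λ x → x + g n + h n) (Σ<-cong n (λ i i<n → g≗h i (m<n⇒m<1+n i<n) (<⇒≢ i<n))) ⟩
  Σ< n h + g n + h n  ≡⟨ solve 3 (λ a b c → a :+ b :+ c := a :+ c :+ b) refl (Σ< n h) (g n) (h n) ⟩
  Σ< n h + h n + g n  ∎
... | no n≢k = begin
  Σ< n g + g n + h k  ≡⟨ solve 3 (λ a b c → a :+ b :+ c := a :+ c :+ b) refl (Σ< n g) (g n) (h k) ⟩
  Σ< n g + h k + g n  ≡⟨ cong₂ _+_ (Σ<-change n g h k k<n (λ i i<n → g≗h i (m<n⇒m<1+n i<n))) (g≗h n ≤-refl n≢k) ⟩
  Σ< n h + g k + h n  ≡⟨ solve 3 (λ a b c → a :+ b :+ c := a :+ c :+ b) refl (Σ< n h) (g k) (h n) ⟩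
  Σ< n h + h n + g k  ∎
  where
  k<n : k < n
  k<n = ≤∧≢⇒< (≤-pred k<1+n) (n≢k ∘ sym)

transpose : ℕ → ℕ → ℕ → ℕ
transpose k b x with x ≟ k
... | yes _ = b
... | no _ with x ≟ b
...   | yes _ = k
...   | no _ = x

transpose-k : ∀ k b → transpose k b k ≡ b
transpose-k k b with k ≟ k
... | yes _ = refl
... | no k≢k = ⊥-elim (k≢k refl)

transpose-b : ∀ k b → transpose k b b ≡ k
transpose-b k b with b ≟ k
... | yes b≡k = b≡k
... | no _ with b ≟ b
...   | yes _ = refl
...   | no b≢b = ⊥-elim (b≢b refl)

transpose-other : ∀ {k b x} → x ≢ k → x ≢ b → transpose k b x ≡ x
transpose-other {k} {b} {x} x≢k x≢b with x ≟ k
... | yes x≡k = ⊥-elim (x≢k x≡k)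
... | no _ with x ≟ b
...   | yes x≡b = ⊥-elim (x≢b x≡b)
...   | no _ = refl

transpose-involutive : ∀ k b x → transpose k b (transpose k b x) ≡ x
transpose-involutive k b x with x ≟ k
... | yes refl = transpose-b x b
... | no x≢k with x ≟ b
...   | yes refl = transpose-k k x
...   | no x≢b = transpose-other x≢k x≢b

transpose-self : ∀ k x → transpose k k x ≡ x
transpose-self k x with x ≟ k
... | yes refl = refl
... | no _ with x ≟ k
...   | yes refl = refl
...   | no _ = refl

transpose-≤ : ∀ {k b x} → k ≤ b → x ≤ b → transpose k b x ≤ b
transpose-≤ {k} {b} {x} k≤b x≤b with x ≟ k
... | yes _ = ≤-refl
... | no _ with x ≟ b
...   | yes _ = k≤b
...   | no _ = x≤b

Σ<-transpose : ∀ k b (f : ℕ → ℕ) → k ≤ b → Σ< (suc b) (f ∘ transpose k b) ≡ Σ< (suc b) f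
Σ<-transpose k b f k≤b with m≤n⇒m<n∨m≡n k≤b
... | inj₂ refl = Σ<-cong (suc k) (λ i _ → cong f (transpose-self k i))
... | inj₁ k<b = begin
  Σ< b (f ∘ transpose k b) + f (transpose k b b) ≡⟨ cong₂ _+_ refl (cong f (transpose-b k b)) ⟩
  Σ< b (f ∘ transpose k b) + f k                 ≡⟨ Σ<-change b (f ∘ transpose k b) f k k<b
                                                      (λ i i<b i≢k → cong f (transpose-other i≢k (<⇒≢ i<b))) ⟩
  Σ< b f + f (transpose k b k)                   ≡⟨ cong₂ _+_ refl (cong f (transpose-k k b)) ⟩
  Σ< b f + f b                                   ∎

Σ<-permute : ∀ b (σ : ℕ → ℕ) → (∀ i → i < b → σ i < b) →
  (∀ i j → i < b → j < b → σ i ≡ σ j → i ≡ j) → ∀ f → Σ< b (f ∘ σ) ≡ Σ< b f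
Σ<-permute zero σ _ _ f = refl
Σ<-permute (suc b) σ σ< σ-inj f = begin
  Σ< (suc b) (f ∘ σ)               ≡⟨ Σ<-cong (suc b) (λ i _ → cong f (sym (transpose-involutive k b (σ i)))) ⟩
  Σ< b (g ∘ ρ) + g (ρ b)           ≡⟨ cong₂ _+_ (Σ<-permute b ρ ρ< ρ-inj g) (cong g (transpose-k k b)) ⟩
  Σ< (suc b) (f ∘ transpose k b)   ≡⟨ Σ<-transpose k b f (≤-pred (σ< b ≤-refl)) ⟩
  Σ< (suc b) f                     ∎
  where
  -- composing with the transposition of σ b and b makes b a fixed point, so ρ restricts to [0, b)
  k = σ b
  g = f ∘ transpose k b
  ρ = transpose k b ∘ σ
  ρ-inj′ : ∀ i j → i ≤ b → j ≤ b → ρ i ≡ ρ j → i ≡ j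
  ρ-inj′ i j i≤b j≤b ρi≡ρj = σ-inj i j (s≤s i≤b) (s≤s j≤b) (begin
    σ i                             ≡⟨ transpose-involutive k b (σ i) ⟨
    transpose k b (ρ i)             ≡⟨ cong (transpose k b) ρi≡ρj ⟩
    transpose k b (ρ j)             ≡⟨ transpose-involutive k b (σ j) ⟩
    σ j                             ∎)
  ρ-inj : ∀ i j → i < b → j < b → ρ i ≡ ρ j → i ≡ j
  ρ-inj i j i<b j<b = ρ-inj′ i j (<⇒≤ i<b) (<⇒≤ j<b)
  ρ< : ∀ i → i < b → ρ i < b
  ρ< i i<b = ≤∧≢⇒< (transpose-≤ (≤-pred (σ< b ≤-refl)) (≤-pred (σ< i (m<n⇒m<1+n i<b))))
    (λ ρi≡b → <⇒≢ i<b (ρ-inj′ i b (<⇒≤ i<b) ≤-refl (trans ρi≡b (sym (transpose-k k b)))))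

-- Coprimality and Euler's totient

coprime-∣ˡ : ∀ {m n d} → Coprime m n → d ∣ m → Coprime d n
coprime-∣ˡ m⊥n d∣m (e∣d , e∣n) = m⊥n (∣-trans e∣d d∣m , e∣n)

coprime-∣ʳ : ∀ {m n d} → Coprime m n → d ∣ n → Coprime m d
coprime-∣ʳ m⊥n d∣n (e∣m , e∣d) = m⊥n (e∣m , ∣-trans e∣d d∣n)

coprime-*ˡ : ∀ {m n o} → Coprime m o → Coprime n o → Coprime (m * n) o
coprime-*ˡ m⊥o n⊥o (d∣mn , d∣o) = n⊥o (coprime-divisor (coprime-sym (coprime-∣ʳ m⊥o d∣o)) d∣mn , d∣o)

coprime-*ʳ : ∀ {m n o} → Coprime o m → Coprime o n → Coprime o (m * n)
coprime-*ʳ o⊥m o⊥n = coprime-sym (coprime-*ˡ (coprime-sym o⊥m) (coprime-sym o⊥n))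

coprime-1 : ∀ m → Coprime m 1
coprime-1 m = coprime-sym (1-coprimeTo m)

1≤divisor : ∀ {d m} → d ∣ m → 1 ≤ m → 1 ≤ d
1≤divisor {zero} d∣m 1≤m = ⊥-elim (<⇒≢ 1≤m (sym (0∣⇒≡0 d∣m)))
1≤divisor {suc _} _ _ = s≤s z≤n

m*n÷m≡n : ∀ m n → 1 ≤ m → (m * n) ÷ m ≡ n
m*n÷m≡n (suc m) n _ = trans (cong (_/ suc m) (*-comm (suc m) n)) (m*n/n≡m n (suc m))

m*n÷n≡m : ∀ m n → 1 ≤ n → (m * n) ÷ n ≡ m
m*n÷n≡m m (suc n) _ = m*n/n≡m m (suc n)

d≢2*d : ∀ {d} → 1 ≤ d → d ≢ 2 * d
d≢2*d {d} 1≤d d≡2d = <⇒≢ (m<m+n d 1≤d) (trans d≡2d (cong₂ _+_ refl (+-identityʳ d)))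

%≡%⇒∣∸ : ∀ x y b .{{_ : NonZero b}} → y ≤ x → x % b ≡ y % b → b ∣ x ∸ y
%≡%⇒∣∸ x y b y≤x x%b≡y%b = divides (x / b ∸ y / b) (begin
  x ∸ y                                             ≡⟨ cong₂ _∸_ (m≡m%n+[m/n]*n x b) (m≡m%n+[m/n]*n y b) ⟩
  (x % b + (x / b) * b) ∸ (y % b + (y / b) * b)     ≡⟨ cong (λ z → (x % b + (x / b) * b) ∸ (z + (y / b) * b)) x%b≡y%b ⟨
  (x % b + (x / b) * b) ∸ (x % b + (y / b) * b)     ≡⟨ [m+n]∸[m+o]≡n∸o (x % b) _ _ ⟩
  (x / b) * b ∸ (y / b) * b                         ≡⟨ *-distribʳ-∸ b (x / b) (y / b) ⟨
  (x / b ∸ y / b) * b                               ∎)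

∣∧<⇒≡0 : ∀ {b m} → b ∣ m → m < b → m ≡ 0
∣∧<⇒≡0 {m = zero} _ _ = refl
∣∧<⇒≡0 {m = suc m} b∣m m<b = ⊥-elim (<⇒≱ m<b (∣⇒≤ b∣m))

m∣n*o⇒m/gcd[m,n]∣o : ∀ {m n o} .{{_ : NonZero (gcd m n)}} → m ∣ n * o → m / gcd m n ∣ o
m∣n*o⇒m/gcd[m,n]∣o {m} {n} {o} m∣n*o = coprime-divisor (coprime-/gcd m n) (*-cancelʳ-∣ g (subst₂ _∣_
  (sym (m/n*n≡m (gcd[m,n]∣m m n)))
  (begin
    n * o            ≡⟨ cong (_* o) (m/n*n≡m (gcd[m,n]∣n m n)) ⟨
    n / g * g * o    ≡⟨ solve 3 (λ a b c → a :* b :* c := a :* c :* b) refl (n / g) g o ⟩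
    n / g * o * g    ∎)
  m∣n*o))
  where
  g = gcd m n

𝟙 : ∀ {P : Set} → Dec P → ℕ
𝟙 (yes _) = 1
𝟙 (no _) = 0

𝟙-yes : ∀ {P : Set} (P? : Dec P) → P → 𝟙 P? ≡ 1
𝟙-yes (yes _) _ = refl
𝟙-yes (no ¬p) p = ⊥-elim (¬p p)

𝟙-no : ∀ {P : Set} (P? : Dec P) → ¬ P → 𝟙 P? ≡ 0
𝟙-no (yes p) ¬p = ⊥-elim (¬p p)
𝟙-no (no _) _ = refl

𝟙-⇔ : ∀ {P Q : Set} (P? : Dec P) (Q? : Dec Q) → P ⇔ Q → 𝟙 P? ≡ 𝟙 Q?
𝟙-⇔ (yes _) (yes _) _ = refl
𝟙-⇔ (no _) (no _) _ = refl
𝟙-⇔ (yes p) (no ¬q) P⇔Q = ⊥-elim (¬q (Equivalence.to P⇔Q p))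
𝟙-⇔ (no ¬p) (yes q) P⇔Q = ⊥-elim (¬p (Equivalence.from P⇔Q q))

length-filter-applyUpTo : ∀ {P : ℕ → Set} (P? : Decidable P) f n →
  length (filter P? (applyUpTo f n)) ≡ Σ< n (λ i → 𝟙 (P? (f i)))
length-filter-applyUpTo P? f zero = refl
length-filter-applyUpTo P? f (suc n) = begin
  length (filter P? (f 0 ∷ applyUpTo (f ∘ suc) n))         ≡⟨ length-filter-∷ (f 0) (applyUpTo (f ∘ suc) n) ⟩
  𝟙 (P? (f 0)) + length (filter P? (applyUpTo (f ∘ suc) n)) ≡⟨ cong₂ _+_ refl (length-filter-applyUpTo P? (f ∘ suc) n) ⟩
  𝟙 (P? (f 0)) + Σ< n (λ i → 𝟙 (P? (f (suc i))))            ≡⟨ Σ<-suc n (λ i → 𝟙 (P? (f i))) ⟨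
  Σ< (suc n) (λ i → 𝟙 (P? (f i)))                           ∎
  where
  length-filter-∷ : ∀ x xs → length (filter P? (x ∷ xs)) ≡ 𝟙 (P? x) + length (filter P? xs)
  length-filter-∷ x xs with P? x
  ... | yes _ = refl
  ... | no _ = refl

coprimeCount : ℕ → ℕ
coprimeCount m = Σ< m (λ k → 𝟙 (coprime? k m))

gcd≡1⇔coprime : ∀ k m → gcd k m ≡ 1 ⇔ Coprime k m
gcd≡1⇔coprime k m = mk⇔ gcd≡1⇒coprime coprime⇒gcd≡1

φ≡coprimeCount : ∀ m → φ m ≡ coprimeCount m
φ≡coprimeCount m = +-cancelˡ-≡ (χ 0) _ _ (begin
  χ 0 + φ m                                ≡⟨ cong₂ _+_ refl (length-filter-applyUpTo (λ k → gcd (suc k) m ≟ 1) id m) ⟩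
  χ 0 + Σ< m (λ k → 𝟙 (gcd (suc k) m ≟ 1)) ≡⟨ cong₂ _+_ refl (Σ<-cong m (λ k _ → 𝟙-⇔ _ _ (gcd≡1⇔coprime (suc k) m))) ⟩
  χ 0 + Σ< m (χ ∘ suc)                     ≡⟨ Σ<-suc m χ ⟨
  coprimeCount m + χ m                     ≡⟨ cong₂ _+_ refl (𝟙-⇔ (coprime? m m) (coprime? 0 m) coprime[m,m]⇔coprime[0,m]) ⟩
  coprimeCount m + χ 0                     ≡⟨ +-comm (coprimeCount m) (χ 0) ⟩
  χ 0 + coprimeCount m                     ∎)
  where
  -- φ counts k ∈ [1, m] and coprimeCount counts k ∈ [0, m): the end points 0 and m behave alike
  χ : ℕ → ℕ
  χ k = 𝟙 (coprime? k m)
  coprime[m,m]⇔coprime[0,m] : Coprime m m ⇔ Coprime 0 m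
  coprime[m,m]⇔coprime[0,m] = mk⇔ (λ m⊥m {_} (_ , d∣m) → m⊥m (d∣m , d∣m)) (λ 0⊥m {d} (d∣m , _) → 0⊥m (d ∣0 , d∣m))

-- m ⊴ t: every prime factor of m divides t (phrased without primes)
_⊴_ : ℕ → ℕ → Set
m ⊴ t = ∀ k → Coprime k t → Coprime k m

-- k < b · a is written i · a + u with u < a, and k ⊥ b · a forces u ⊥ a
coprimeCount-fibres : ∀ a b K →
  (∀ u → u < a → Coprime u a → Σ< b (λ i → 𝟙 (coprime? (i * a + u) (b * a))) ≡ K) →
  coprimeCount (b * a) ≡ coprimeCount a * K
coprimeCount-fibres a b K fibre = begin
  Σ< (b * a) (λ k → χ k)                            ≡⟨ Σ<-blocks b a χ ⟩
  Σ< b (λ i → Σ< a (λ u → χ (i * a + u)))           ≡⟨ Σ<-swap b a (λ u i → χ (i * a + u)) ⟩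
  Σ< a (λ u → Σ< b (λ i → χ (i * a + u)))           ≡⟨ Σ<-cong a fibre′ ⟩
  Σ< a (λ u → 𝟙 (coprime? u a) * K)                 ≡⟨ Σ<-*ʳ a (λ u → 𝟙 (coprime? u a)) K ⟩
  coprimeCount a * K                                ∎
  where
  χ : ℕ → ℕ
  χ k = 𝟙 (coprime? k (b * a))
  fibre′ : ∀ u → u < a → Σ< b (λ i → χ (i * a + u)) ≡ 𝟙 (coprime? u a) * K
  fibre′ u u<a with coprime? u a
  ... | yes u⊥a = trans (fibre u u<a u⊥a) (sym (+-identityʳ K))
  ... | no u⊥̸a = Σ<-zero b _ (λ i _ → 𝟙-no (coprime? _ _) (λ ia+u⊥ba → u⊥̸a (λ (d∣u , d∣a) →
                    ia+u⊥ba (∣m∣n⇒∣m+n (∣n⇒∣m*n i d∣a) d∣u , ∣n⇒∣m*n b d∣a))))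

coprime-+-* : ∀ {a u} i → Coprime u a → Coprime (i * a + u) a
coprime-+-* i u⊥a (d∣ia+u , d∣a) = u⊥a (∣m+n∣m⇒∣n d∣ia+u (∣n⇒∣m*n i d∣a) , d∣a)

coprimeCount-⊴ : ∀ t g → (g * t) ⊴ t → coprimeCount (g * t) ≡ coprimeCount t * g
coprimeCount-⊴ t g gt⊴t = coprimeCount-fibres t g g (λ u _ u⊥t → begin
  Σ< g (λ i → 𝟙 (coprime? (i * t + u) (g * t)))   ≡⟨ Σ<-cong g (λ i _ → 𝟙-yes (coprime? _ _) (gt⊴t _ (coprime-+-* i u⊥t))) ⟩
  Σ< g (λ _ → 1)                                  ≡⟨ Σ<-const g 1 ⟩
  g * 1                                           ≡⟨ *-identityʳ g ⟩
  g                                               ∎)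

*+-mod-injective-≤ : ∀ a b u .{{_ : NonZero b}} → Coprime a b → ∀ {i j} → j ≤ i → i < b →
  (i * a + u) % b ≡ (j * a + u) % b → j ≡ i
*+-mod-injective-≤ a b u a⊥b {i} {j} j≤i i<b eq =
  ≤-antisym j≤i (m∸n≡0⇒m≤n (∣∧<⇒≡0 b∣i∸j (≤-<-trans (m∸n≤m i j) i<b)))
  where
  b∣i∸j : b ∣ i ∸ j
  b∣i∸j = coprime-divisor (coprime-sym a⊥b) (subst (b ∣_) (begin
    (i * a + u) ∸ (j * a + u)   ≡⟨ cong₂ _∸_ (+-comm (i * a) u) (+-comm (j * a) u) ⟩
    (u + i * a) ∸ (u + j * a)   ≡⟨ [m+n]∸[m+o]≡n∸o u (i * a) (j * a) ⟩
    i * a ∸ j * a               ≡⟨ *-distribʳ-∸ a i j ⟨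
    (i ∸ j) * a                 ≡⟨ *-comm (i ∸ j) a ⟩
    a * (i ∸ j)                 ∎) (%≡%⇒∣∸ _ _ b (+-monoˡ-≤ u (*-monoˡ-≤ a j≤i)) eq))

*+-mod-injective : ∀ a b u .{{_ : NonZero b}} → Coprime a b → ∀ i j → i < b → j < b →
  (i * a + u) % b ≡ (j * a + u) % b → i ≡ j
*+-mod-injective a b u a⊥b i j i<b j<b eq with ≤-total j i
... | inj₁ j≤i = sym (*+-mod-injective-≤ a b u a⊥b j≤i i<b eq)
... | inj₂ i≤j = *+-mod-injective-≤ a b u a⊥b i≤j j<b (sym eq)

-- Chinese remainder theorem: i ↦ (i · a + u) mod b permutes [0, b)
coprimeCount-* : ∀ a b .{{_ : NonZero b}} → Coprime a b → coprimeCount (b * a) ≡ coprimeCount a * coprimeCount b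
coprimeCount-* a b a⊥b = coprimeCount-fibres a b (coprimeCount b) (λ u _ u⊥a → begin
  Σ< b (λ i → 𝟙 (coprime? (i * a + u) (b * a)))     ≡⟨ Σ<-cong b (λ i _ → 𝟙-⇔ _ _ (coprime-[*a]⇔coprime-[%b] i u⊥a)) ⟩
  Σ< b (λ i → 𝟙 (coprime? ((i * a + u) % b) b))     ≡⟨ Σ<-permute b (λ i → (i * a + u) % b) (λ i _ → m%n<n _ b)
                                                         (*+-mod-injective a b u a⊥b) (λ k → 𝟙 (coprime? k b)) ⟩
  coprimeCount b                                    ∎)
  where
  coprime-[*a]⇔coprime-[%b] : ∀ {u} i → Coprime u a → Coprime (i * a + u) (b * a) ⇔ Coprime ((i * a + u) % b) b
  coprime-[*a]⇔coprime-[%b] {u} i u⊥a = mk⇔ to from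
    where
    x = i * a + u
    to : Coprime x (b * a) → Coprime (x % b) b
    to x⊥ba (d∣x%b , d∣b) = x⊥ba (∣n∣m%n⇒∣m d∣b d∣x%b , ∣m⇒∣m*n a d∣b)
    from : Coprime (x % b) b → Coprime x (b * a)
    from x%b⊥b = coprime-*ʳ (λ (d∣x , d∣b) → x%b⊥b (%-presˡ-∣ d∣x d∣b , d∣b)) (coprime-+-* i u⊥a)

coprimeCount-pos : ∀ t → 1 ≤ t → 1 ≤ coprimeCount t
coprimeCount-pos (suc zero) _ = ≤-refl
coprimeCount-pos (suc (suc t)) _ = ≤-trans (≤-reflexive (sym (𝟙-yes (coprime? 1 (2 + t)) (1-coprimeTo (2 + t)))))
  (Σ<-term (2 + t) (λ k → 𝟙 (coprime? k (2 + t))) 1 (s≤s (s≤s z≤n)))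

coprimeCount-odd-even : ∀ m → Odd m → m ≢ 1 → parity (coprimeCount m) ≡ 0ℙ
coprimeCount-odd-even m odd-m m≢1 with odd⇒≡1+2h m odd-m
... | h , refl = begin
  parity (coprimeCount m)     ≡⟨ cong parity coprimeCount≡S+S ⟩
  parity (S + S)              ≡⟨ ℙ.+-homo-+ S S ⟩
  parity S ℙ.+ parity S       ≡⟨ ℙ.p+p≡0ℙ (parity S) ⟩
  0ℙ                          ∎
  where
  -- k ↦ m ∸ k pairs off the units in [1, 2h]
  χ : ℕ → ℕ
  χ k = 𝟙 (coprime? k m)
  S = Σ< h (χ ∘ suc)
  χ0≡0 : χ 0 ≡ 0
  χ0≡0 = 𝟙-no (coprime? 0 m) (λ 0⊥m → m≢1 (0⊥m (m ∣0 , ∣-refl)))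
  χ-reflect : ∀ i → i < h → χ (suc (h + i)) ≡ χ (suc (h ∸ suc i))
  χ-reflect i i<h = trans (𝟙-⇔ _ _ (mk⇔ (complement k≤m) (subst (λ x → Coprime x m) m∸[m∸k]≡k ∘ complement (m∸n≤m m k))))
    (cong χ (trans ([m+n]∸[m+o]≡n∸o h h i) (+-∸-assoc 1 i<h)))
    where
    k = suc (h + i)
    k≤m : k ≤ m
    k≤m = s≤s (+-monoʳ-≤ h (<⇒≤ i<h))
    m∸[m∸k]≡k : m ∸ (m ∸ k) ≡ k
    m∸[m∸k]≡k = m∸[m∸n]≡n k≤m
    complement : ∀ {k} → k ≤ m → Coprime k m → Coprime (m ∸ k) m
    complement {k} k≤m k⊥m {d} (d∣m∸k , d∣m) =
      k⊥m (∣m+n∣m⇒∣n (subst (d ∣_) (sym (m∸n+n≡m k≤m)) d∣m) d∣m∸k , d∣m)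
  coprimeCount≡S+S : coprimeCount m ≡ S + S
  coprimeCount≡S+S = begin
    coprimeCount m                           ≡⟨ Σ<-suc (h + h) χ ⟩
    χ 0 + Σ< (h + h) (χ ∘ suc)               ≡⟨ cong₂ _+_ χ0≡0 (Σ<-split h h (χ ∘ suc)) ⟩
    S + Σ< h (λ i → χ (suc (h + i)))         ≡⟨ cong₂ _+_ refl (Σ<-cong h χ-reflect) ⟩
    S + Σ< h (λ i → χ (suc (h ∸ suc i)))     ≡⟨ cong₂ _+_ refl (Σ<-reverse h (χ ∘ suc)) ⟩
    S + S                                    ∎

record Split (t m : ℕ) : Set where
  constructor split
  field
    part free : ℕ
    m≡free*part : m ≡ free * part
    part⊥free : Coprime part free
    free⊥t : Coprime free t
    part⊴t : part ⊴ t

split-by : ∀ t m → 1 ≤ m → Split t m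
split-by t m = go m (<-wellFounded m)
  where
  go : ∀ m → Acc _<_ m → 1 ≤ m → Split t m
  go m (acc rec) 1≤m with gcd m t in g≡ | gcd[m,n]∣m m t | gcd[m,n]∣n m t
  ... | zero | divides q m≡q*0 | _ = ⊥-elim (<⇒≢ 1≤m (sym (trans m≡q*0 (*-zeroʳ q))))
  ... | suc zero | _ | _ = split 1 m (sym (*-identityʳ m)) (1-coprimeTo m) (gcd≡1⇒coprime g≡) (λ k _ → coprime-1 k)
  ... | g@(suc (suc _)) | divides q m≡q*g | g∣t = extend (go q (rec q<m) 1≤q)
    where
    1≤q : 1 ≤ q
    1≤q = n≢0⇒n>0 (λ { refl → <⇒≢ 1≤m (sym m≡q*g) })
    q<m : q < m
    q<m = subst (q <_) (sym m≡q*g) (m<m*n q g {{>-nonZero 1≤q}} (s≤s (s≤s z≤n)))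
    extend : Split t q → Split t m
    extend (split part free q≡free*part part⊥free free⊥t part⊴t) =
      split (g * part) free m≡ (coprime-*ˡ (coprime-sym (coprime-∣ʳ free⊥t g∣t)) part⊥free) free⊥t
        (λ k k⊥t → coprime-*ʳ (coprime-∣ʳ k⊥t g∣t) (part⊴t k k⊥t))
      where
      m≡ : m ≡ free * (g * part)
      m≡ = begin
        m                   ≡⟨ m≡q*g ⟩
        q * g               ≡⟨ cong (_* g) q≡free*part ⟩
        free * part * g     ≡⟨ solve 3 (λ f p g → f :* p :* g := f :* (g :* p)) refl free part g ⟩
        free * (g * part)   ∎

-- Square-free numbers and radicals

SquareFree : ℕ → Set
SquareFree m = ∀ d → d * d ∣ m → d ≤ 1

private
  allTrue : List Bool → Bool
  allTrue = foldr (λ b acc → if b then acc else false) true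

  allTrue⇒ : ∀ bs → allTrue bs ≡ true → ∀ {b} → b ∈ bs → b ≡ true
  allTrue⇒ (true ∷ bs) all (here refl) = refl
  allTrue⇒ (true ∷ bs) all (there b∈bs) = allTrue⇒ bs all b∈bs

  allTrue⇐ : ∀ bs → (∀ {b} → b ∈ bs → b ≡ true) → allTrue bs ≡ true
  allTrue⇐ [] _ = refl
  allTrue⇐ (b ∷ bs) all rewrite all (here refl) = allTrue⇐ bs (all ∘ there)

  allTrue≡false⇒ : ∀ bs → allTrue bs ≡ false → false ∈ bs
  allTrue≡false⇒ (false ∷ bs) _ = here refl
  allTrue≡false⇒ (true ∷ bs) all = there (allTrue≡false⇒ bs all)

  squareTest : ℕ → ℕ → Bool
  squareTest m d = does (¬? ((suc (suc d) * suc (suc d)) ∣? m))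

-- squarefree m tests the divisors (2 + i)² for i < m
square-test-bound : ∀ {m} d .{{_ : NonZero m}} → (2 + d) * (2 + d) ∣ m → d < m
square-test-bound d dd∣m = ≤-trans (s≤s (n≤1+n d)) (≤-trans (m≤m*n (2 + d) (2 + d)) (∣⇒≤ dd∣m))

squarefree⇒SquareFree : ∀ m → 1 ≤ m → squarefree m ≡ true → SquareFree m
squarefree⇒SquareFree m 1≤m sf zero _ = z≤n
squarefree⇒SquareFree m 1≤m sf (suc zero) _ = ≤-refl
squarefree⇒SquareFree m 1≤m sf d@(suc (suc d′)) dd∣m = ⊥-elim (false≢true (begin
  false                        ≡⟨ cong not (dec-true ((d * d) ∣? m) dd∣m) ⟨
  squareTest m d′              ≡⟨ allTrue⇒ (map (squareTest m) (upTo m)) sf d′-tested ⟩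
  true                         ∎))
  where
  d′-tested : squareTest m d′ ∈ map (squareTest m) (upTo m)
  d′-tested = ∈-map⁺ (squareTest m) (∈-upTo⁺ (square-test-bound d′ {{>-nonZero 1≤m}} dd∣m))
  false≢true : false ≢ true
  false≢true ()

SquareFree⇒squarefree : ∀ m → SquareFree m → squarefree m ≡ true
SquareFree⇒squarefree m sqf = allTrue⇐ (map (squareTest m) (upTo m)) λ b∈ → case ∈-map⁻ (squareTest m) b∈ of λ
  { (i , _ , refl) → cong not (dec-false (((2 + i) * (2 + i)) ∣? m) λ dd∣m → case sqf (2 + i) dd∣m of λ { (s≤s ()) }) }

squarefree≡false⇒square-divisor : ∀ m → squarefree m ≡ false → ∃ λ d → 2 ≤ d × d * d ∣ m
squarefree≡false⇒square-divisor m sf with ∈-map⁻ (squareTest m) (allTrue≡false⇒ (map (squareTest m) (upTo m)) sf)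
... | i , _ , false≡test = 2 + i , s≤s (s≤s z≤n) ,
  decidable-stable dd∣m? (λ dd∤m → true≢false (trans (sym (cong not (dec-false dd∣m? dd∤m))) (sym false≡test)))
  where
  dd∣m? = ((2 + i) * (2 + i)) ∣? m
  true≢false : true ≢ false
  true≢false ()

squareFree-∣ : ∀ {m n} → m ∣ n → SquareFree n → SquareFree m
squareFree-∣ m∣n sqf d dd∣m = sqf d (∣-trans dd∣m m∣n)

∃-squareFree-radical : ∀ o → 1 ≤ o → ∃ λ r → r ∣ o × SquareFree r × o ⊴ r
∃-squareFree-radical o = go o (<-wellFounded o)
  where
  go : ∀ o → Acc _<_ o → 1 ≤ o → ∃ λ r → r ∣ o × SquareFree r × o ⊴ r
  go o (acc rec) 1≤o with squarefree o in sf
  ... | true = o , ∣-refl , squarefree⇒SquareFree o 1≤o sf , (λ _ k⊥o → k⊥o)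
  ... | false with squarefree≡false⇒square-divisor o sf
  ... | d , 2≤d , divides w o≡w*[d*d] = extend (go o′ (rec o′<o) 1≤o′)
    where
    o′ = w * d
    o≡o′*d : o ≡ o′ * d
    o≡o′*d = trans o≡w*[d*d] (sym (*-assoc w d d))
    1≤o′ : 1 ≤ o′
    1≤o′ = n≢0⇒n>0 (λ o′≡0 → <⇒≢ 1≤o (sym (trans o≡o′*d (cong (_* d) o′≡0))))
    o′<o : o′ < o
    o′<o = subst (o′ <_) (sym o≡o′*d) (m<m*n o′ d {{>-nonZero 1≤o′}} 2≤d)
    -- o = o′ d and d ∣ o′, so o has the prime factors of o′
    extend : ∃ (λ r → r ∣ o′ × SquareFree r × o′ ⊴ r) → ∃ λ r → r ∣ o × SquareFree r × o ⊴ r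
    extend (r , r∣o′ , sqf , o′⊴r) = r , ∣-trans r∣o′ (divides d (trans o≡o′*d (*-comm o′ d))) , sqf ,
      (λ k k⊥r → subst (Coprime k) (sym o≡o′*d) (coprime-*ʳ (o′⊴r k k⊥r) (coprime-∣ʳ (o′⊴r k k⊥r) (n∣m*n w))))

squareFree-⊴⇒∣ : ∀ {t r} → 1 ≤ t → SquareFree t → t ⊴ r → t ∣ r
squareFree-⊴⇒∣ {t} {r} 1≤t sqf t⊴r with gcd[m,n]∣m t r
... | divides s t≡s*g = subst (_∣ r) (sym t≡g) (gcd[m,n]∣n t r)
  where
  -- t = s · gcd t r, and every common divisor of s and gcd t r squares into t
  g = gcd t r
  g∣t : g ∣ t
  g∣t = gcd[m,n]∣m t r
  s∣t : s ∣ t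
  s∣t = divides g (trans t≡s*g (*-comm s g))
  g⊥s : Coprime g s
  g⊥s {d} (d∣g , d∣s) with sqf d (subst (d * d ∣_) (sym t≡s*g) (*-pres-∣ d∣s d∣g))
  ... | z≤n = ⊥-elim (<⇒≢ 1≤t (sym (0∣⇒≡0 (∣-trans d∣g g∣t))))
  ... | s≤s z≤n = refl
  s⊥r : Coprime s r
  s⊥r (d∣s , d∣r) = g⊥s (gcd-greatest (∣-trans d∣s s∣t) d∣r , d∣s)
  t≡g : t ≡ g
  t≡g = trans t≡s*g (trans (cong (_* g) (t⊴r s s⊥r (∣-refl , s∣t))) (*-identityˡ g))

-- Parity of Ramanujan sums at odd j

odd[φ[g*t]÷φ[t]]⇒⊴ : ∀ t g → 1 ≤ g * t → Odd g → Odd (φ (g * t) ÷ φ t) → (g * t) ⊴ t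
odd[φ[g*t]÷φ[t]]⇒⊴ t g 1≤m odd-g odd-ratio with split-by t (g * t) 1≤m
... | split part free m≡ part⊥free free⊥t part⊴t with free ≟ 1
...   | yes refl = subst (_⊴ t) (sym (trans m≡ (*-identityˡ part))) part⊴t
...   | no free≢1 = ⊥-elim (odd⇒¬2∣ odd-ratio (parity≡0ℙ⇒2∣ (φ (g * t) ÷ φ t) ratio-even))
  where
  -- the part of g · t coprime to t is odd and > 1, so its totient is even
  m = g * t
  1≤t : 1 ≤ t
  1≤t = n≢0⇒n>0 (λ { refl → <⇒≢ 1≤m (sym (*-zeroʳ g)) })
  1≤free : 1 ≤ free
  1≤free = n≢0⇒n>0 (λ { refl → <⇒≢ 1≤m (sym m≡) })
  t∣part : t ∣ part
  t∣part = coprime-divisor (coprime-sym free⊥t) (subst (t ∣_) m≡ (n∣m*n g))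
  e = quotient t∣part
  part≡e*t : part ≡ e * t
  part≡e*t = m∣n⇒n≡quotient*m t∣part
  odd-free : Odd free
  odd-free = ¬2∣⇒odd free (λ 2∣free → case free⊥t (2∣free , coprime-divisor (odd⇒coprime-2 {g} odd-g)
    (subst (2 ∣_) (sym m≡) (∣m⇒∣m*n part 2∣free))) of λ ())
  φm≡ : φ m ≡ coprimeCount t * (e * coprimeCount free)
  φm≡ = begin
    φ m                                           ≡⟨ trans (φ≡coprimeCount m) (cong coprimeCount m≡) ⟩
    coprimeCount (free * part)                    ≡⟨ coprimeCount-* part free {{>-nonZero 1≤free}} part⊥free ⟩
    coprimeCount part * coprimeCount free         ≡⟨ cong (λ x → coprimeCount x * coprimeCount free) part≡e*t ⟩
    coprimeCount (e * t) * coprimeCount free      ≡⟨ cong (_* coprimeCount free) (coprimeCount-⊴ t e (subst (_⊴ t) part≡e*t part⊴t)) ⟩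
    coprimeCount t * e * coprimeCount free        ≡⟨ *-assoc (coprimeCount t) e (coprimeCount free) ⟩
    coprimeCount t * (e * coprimeCount free)      ∎
  ratio-even : parity (φ m ÷ φ t) ≡ 0ℙ
  ratio-even = begin
    parity (φ m ÷ φ t)                                             ≡⟨ cong parity (cong₂ _÷_ φm≡ (φ≡coprimeCount t)) ⟩
    parity ((coprimeCount t * (e * coprimeCount free)) ÷ coprimeCount t)
                                                                   ≡⟨ cong parity (m*n÷m≡n _ _ (coprimeCount-pos t 1≤t)) ⟩
    parity (e * coprimeCount free)                                 ≡⟨ ℙ.*-homo-* e (coprimeCount free) ⟩
    parity e ℙ.* parity (coprimeCount free)                        ≡⟨ cong (parity e ℙ.*_) (coprimeCount-odd-even free odd-free free≢1) ⟩
    parity e ℙ.* 0ℙ                                                ≡⟨ ℙ.*-zeroʳ (parity e) ⟩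
    0ℙ                                                             ∎

φ[g*t]÷φ[t]≡g : ∀ t g → 1 ≤ t → (g * t) ⊴ t → φ (g * t) ÷ φ t ≡ g
φ[g*t]÷φ[t]≡g t g 1≤t gt⊴t = begin
  φ (g * t) ÷ φ t                         ≡⟨ cong₂ _÷_ (φ≡coprimeCount (g * t)) (φ≡coprimeCount t) ⟩
  coprimeCount (g * t) ÷ coprimeCount t   ≡⟨ cong (_÷ coprimeCount t) (coprimeCount-⊴ t g gt⊴t) ⟩
  (coprimeCount t * g) ÷ coprimeCount t   ≡⟨ m*n÷m≡n (coprimeCount t) g (coprimeCount-pos t 1≤t) ⟩
  g                                       ∎

odd-φ-ratio⇔ : ∀ t g → 1 ≤ g * t → Odd g → Odd (φ (g * t) ÷ φ t) ⇔ (g * t) ⊴ t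
odd-φ-ratio⇔ t g 1≤gt odd-g = mk⇔ (odd[φ[g*t]÷φ[t]]⇒⊴ t g 1≤gt odd-g)
  (λ gt⊴t → subst Odd (sym (φ[g*t]÷φ[t]≡g t g (1≤divisor (n∣m*n g) 1≤gt) gt⊴t)) odd-g)

odd-μ⇔squarefree : ∀ m → parityℤ (μ m) ≡ 1ℙ ⇔ squarefree m ≡ true
odd-μ⇔squarefree m with squarefree m
... | true = mk⇔ (λ _ → refl) (λ _ → parityℤ-[-1]^ (ω m))
... | false = mk⇔ (λ ()) (λ ())

m≡gcd*t : ∀ m j → 1 ≤ m → m ≡ gcd m j * t m j
m≡gcd*t m j 1≤m with gcd m j | gcd[m,n]∣m m j
... | zero | divides q m≡q*0 = ⊥-elim (<⇒≢ 1≤m (sym (trans m≡q*0 (*-zeroʳ q))))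
... | suc g | divides q m≡q*g = begin
  m                    ≡⟨ m≡q*g ⟩
  q * suc g            ≡⟨ *-comm q (suc g) ⟩
  suc g * q            ≡⟨ cong (suc g *_) (trans (cong (_/ suc g) m≡q*g) (m*n/n≡m q (suc g))) ⟨
  suc g * (m / suc g)  ∎

t∣m : ∀ m j → 1 ≤ m → t m j ∣ m
t∣m m j 1≤m = divides (gcd m j) (m≡gcd*t m j 1≤m)

odd-μ⇔SquareFree : ∀ m → 1 ≤ m → parityℤ (μ m) ≡ 1ℙ ⇔ SquareFree m
odd-μ⇔SquareFree m 1≤m = ⇔.trans (odd-μ⇔squarefree m) (mk⇔ (squarefree⇒SquareFree m 1≤m) (SquareFree⇒squarefree m))

odd-c⇔ : ∀ j m → Odd j → 1 ≤ m → parityℤ (c j m) ≡ 1ℙ ⇔ (SquareFree (t m j) × m ⊴ t m j)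
odd-c⇔ j m odd-j 1≤m = subst (λ p → (p ≡ 1ℙ) ⇔ (SquareFree τ × m ⊴ τ)) (sym (parityℤ-* (μ τ) (+ (φ m ÷ φ τ))))
  (⇔.trans (*≡1ℙ⇔ _ _) (odd-μ⇔SquareFree τ 1≤τ ×-⇔ subst (λ x → Odd (φ x ÷ φ τ) ⇔ x ⊴ τ) (sym m≡)
    (odd-φ-ratio⇔ τ g (subst (1 ≤_) m≡ 1≤m) (odd-∣ (gcd[m,n]∣n m j) odd-j))))
  where
  τ = t m j
  g = gcd m j
  m≡ : m ≡ g * τ
  m≡ = m≡gcd*t m j 1≤m
  1≤τ : 1 ≤ τ
  1≤τ = 1≤divisor (t∣m m j 1≤m) 1≤m

gcd[2*o,j]≡gcd[o,j] : ∀ o j → Odd j → gcd (2 * o) j ≡ gcd o j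
gcd[2*o,j]≡gcd[o,j] o j odd-j = ∣-antisym
  (gcd-greatest {o} {j} (coprime-divisor (coprime-sym (odd⇒coprime-2 (odd-∣ (gcd[m,n]∣n (2 * o) j) odd-j))) (gcd[m,n]∣m (2 * o) j))
    (gcd[m,n]∣n (2 * o) j))
  (gcd-greatest {2 * o} {j} (∣n⇒∣m*n 2 (gcd[m,n]∣m o j)) (gcd[m,n]∣n o j))

t[2*o]≡2*t : ∀ o j → 1 ≤ o → Odd j → t (2 * o) j ≡ 2 * t o j
t[2*o]≡2*t o j 1≤o odd-j = begin
  (2 * o) ÷ gcd (2 * o) j    ≡⟨ cong ((2 * o) ÷_) (gcd[2*o,j]≡gcd[o,j] o j odd-j) ⟩
  (2 * o) ÷ gcd o j          ≡⟨ cong (λ x → (2 * x) ÷ gcd o j) (m≡gcd*t o j 1≤o) ⟩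
  (2 * (g * τ)) ÷ g          ≡⟨ cong (_÷ g) (solve 2 (λ a b → con 2 :* (a :* b) := a :* (con 2 :* b)) refl g τ) ⟩
  (g * (2 * τ)) ÷ g          ≡⟨ m*n÷m≡n g (2 * τ) 1≤g ⟩
  2 * τ                      ∎
  where
  g = gcd o j
  τ = t o j
  1≤g : 1 ≤ g
  1≤g = 1≤divisor (gcd[m,n]∣m o j) 1≤o

squareFree-2*⇔ : ∀ x → Odd x → SquareFree (2 * x) ⇔ SquareFree x
squareFree-2*⇔ x odd-x = mk⇔ (squareFree-∣ (n∣m*n 2 {x})) from
  where
  from : SquareFree x → SquareFree (2 * x)
  from sqf d dd∣2x with parity d in parity-d
  ... | 1ℙ = sqf d (coprime-divisor (coprime-sym (odd⇒coprime-2 (odd-* {d} {d} parity-d parity-d))) dd∣2x)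
  ... | 0ℙ = ⊥-elim (odd⇒¬2∣ odd-x (*-cancelˡ-∣ {2} {x} 2 (∣-trans (*-pres-∣ 2∣d 2∣d) dd∣2x)))
    where
    2∣d : 2 ∣ d
    2∣d = parity≡0ℙ⇒2∣ d parity-d

⊴-2*⇔ : ∀ o s → Odd o → (2 * o) ⊴ (2 * s) ⇔ o ⊴ s
⊴-2*⇔ o s odd-o = mk⇔ to from
  where
  to : (2 * o) ⊴ (2 * s) → o ⊴ s
  to 2o⊴2s k k⊥s {d} (d∣k , d∣o) = 2o⊴2s d d⊥2s (∣-refl , ∣n⇒∣m*n 2 d∣o)
    where
    d⊥2s : Coprime d (2 * s)
    d⊥2s = coprime-*ʳ (coprime-sym (odd⇒coprime-2 (odd-∣ d∣o odd-o))) (coprime-∣ˡ k⊥s d∣k)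
  from : o ⊴ s → (2 * o) ⊴ (2 * s)
  from o⊴s k k⊥2s = coprime-*ʳ (coprime-∣ʳ k⊥2s (m∣m*n {2} s)) (o⊴s k (coprime-∣ʳ k⊥2s (n∣m*n 2)))

c[2*o]-parity : ∀ j o → Odd j → Odd o → parityℤ (c j (2 * o)) ≡ parityℤ (c j o)
c[2*o]-parity j o odd-j odd-o = ≡1ℙ⇔⇒≡ (⇔.trans (odd-c⇔ j (2 * o) odd-j (≤-trans 1≤o (m≤m+n o _)))
  (⇔.trans (subst (λ x → (SquareFree x × (2 * o) ⊴ x) ⇔ (SquareFree τ × o ⊴ τ)) (sym (t[2*o]≡2*t o j 1≤o odd-j))
                  (squareFree-2*⇔ τ odd-τ ×-⇔ ⊴-2*⇔ o τ odd-o))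
           (⇔.sym (odd-c⇔ j o odd-j 1≤o))))
  where
  τ = t o j
  1≤o : 1 ≤ o
  1≤o = odd⇒1≤ odd-o
  odd-τ : Odd τ
  odd-τ = odd-∣ (t∣m o j 1≤o) odd-o

∃-minimal : ∀ {A : Set} {P : A → Set} (P? : Decidable P) (key : A → ℕ) {x} xs → x ∈ xs → P x →
  ∃ λ y → y ∈ xs × P y × (∀ {z} → z ∈ xs → P z → key y ≤ key z)
∃-minimal {P = P} P? key {x} xs x∈xs px =
  y , proj₁ y∈xs×py , proj₂ y∈xs×py , λ z∈xs pz → All.lookup (f[argmin]≤f[xs] x (filter P? xs)) (∈-filter⁺ P? z∈xs pz)
  where
  y = argmin key x (filter P? xs)
  y∈xs×py : y ∈ xs × P y
  y∈xs×py = argmin-all key {P = λ y → y ∈ xs × P y} (x∈xs , px) (All.tabulate (∈-filter⁻ P?))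

module ParitySum {A : Set} (_≟ᴬ_ : DecidableEquality A) where

  Σℙ : (A → Parity) → List A → Parity
  Σℙ f [] = 0ℙ
  Σℙ f (x ∷ xs) = f x ℙ.+ Σℙ f xs

  _∖_ : List A → A → List A
  xs ∖ a = filter (λ x → ¬? (x ≟ᴬ a)) xs

  ∈-∖⁺ : ∀ {x a xs} → x ∈ xs → x ≢ a → x ∈ xs ∖ a
  ∈-∖⁺ {a = a} = ∈-filter⁺ (λ x → ¬? (x ≟ᴬ a))

  ∈-∖⁻ : ∀ {x a xs} → x ∈ xs ∖ a → x ∈ xs × x ≢ a
  ∈-∖⁻ {a = a} = ∈-filter⁻ (λ x → ¬? (x ≟ᴬ a))

  unique-∖ : ∀ {a xs} → Unique xs → Unique (xs ∖ a)
  unique-∖ {a} = Unique.filter⁺ (λ x → ¬? (x ≟ᴬ a))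

  length-∖ : ∀ {a xs} → a ∈ xs → length (xs ∖ a) < length xs
  length-∖ {a} {xs} a∈xs = filter-notAll (λ x → ¬? (x ≟ᴬ a)) xs (Any.map (λ a≡x x≢a → x≢a (sym a≡x)) a∈xs)

  Σℙ-∖ : ∀ f {a} xs → Unique xs → a ∈ xs → Σℙ f xs ≡ f a ℙ.+ Σℙ f (xs ∖ a)
  Σℙ-∖ f (x ∷ xs) (x≢xs ∷ _) (here refl) = cong (λ ys → f x ℙ.+ Σℙ f ys) (sym (begin
    (x ∷ xs) ∖ x   ≡⟨ filter-reject (λ y → ¬? (y ≟ᴬ x)) (λ x≢x → x≢x refl) ⟩
    xs ∖ x         ≡⟨ filter-all (λ y → ¬? (y ≟ᴬ x)) (All.map (λ x≢y y≡x → x≢y (sym y≡x)) x≢xs) ⟩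
    xs             ∎))
  Σℙ-∖ f {a} (x ∷ xs) (x≢xs ∷ uniq) (there a∈xs) = begin
    f x ℙ.+ Σℙ f xs                         ≡⟨ cong (f x ℙ.+_) (Σℙ-∖ f xs uniq a∈xs) ⟩
    f x ℙ.+ (f a ℙ.+ Σℙ f (xs ∖ a))         ≡⟨ ℙ.+-assoc (f x) (f a) _ ⟨
    (f x ℙ.+ f a) ℙ.+ Σℙ f (xs ∖ a)         ≡⟨ cong (ℙ._+ Σℙ f (xs ∖ a)) (ℙ.+-comm (f x) (f a)) ⟩
    (f a ℙ.+ f x) ℙ.+ Σℙ f (xs ∖ a)         ≡⟨ ℙ.+-assoc (f a) (f x) _ ⟩
    f a ℙ.+ Σℙ f (x ∷ (xs ∖ a))             ≡⟨ cong (λ ys → f a ℙ.+ Σℙ f ys) (filter-accept (λ y → ¬? (y ≟ᴬ a)) x≢a) ⟨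
    f a ℙ.+ Σℙ f ((x ∷ xs) ∖ a)             ∎
    where
    x≢a : x ≢ a
    x≢a = All.lookup x≢xs a∈xs

  PairsOff : (A → Parity) → (A → A) → List A → Set
  PairsOff f σ xs = ∀ {x} → x ∈ xs → f x ≡ 1ℙ → σ x ∈ xs × f (σ x) ≡ 1ℙ × σ x ≢ x × σ (σ x) ≡ x

  Σℙ-pairedOff : ∀ f σ xs → Unique xs → PairsOff f σ xs → Σℙ f xs ≡ 0ℙ
  Σℙ-pairedOff f σ xs = go xs (<-wellFounded (length xs))
    where
    go : ∀ xs → Acc _<_ (length xs) → Unique xs → PairsOff f σ xs → Σℙ f xs ≡ 0ℙ
    go [] _ _ _ = refl
    go (x ∷ xs) (acc rec) (x≢xs ∷ uniq) pairs with f x in fx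
    ... | 0ℙ = go xs (rec ≤-refl) uniq pairs′
      where
      pairs′ : PairsOff f σ xs
      pairs′ y∈xs fy with pairs (there y∈xs) fy
      ... | here σy≡x , fσy , _ = case trans (sym fx) (trans (cong f (sym σy≡x)) fσy) of λ ()
      ... | there σy∈xs , rest = σy∈xs , rest
    ... | 1ℙ with pairs (here refl) fx
    ...   | here σx≡x , _ , σx≢x , _ = ⊥-elim (σx≢x σx≡x)
    ...   | there σx∈xs , fσx , _ , σσx≡x = begin
      1ℙ ℙ.+ Σℙ f xs                               ≡⟨ cong (1ℙ ℙ.+_) (Σℙ-∖ f xs uniq σx∈xs) ⟩
      1ℙ ℙ.+ (f (σ x) ℙ.+ Σℙ f (xs ∖ σ x))         ≡⟨ cong (λ p → 1ℙ ℙ.+ (p ℙ.+ Σℙ f (xs ∖ σ x))) fσx ⟩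
      1ℙ ℙ.+ (1ℙ ℙ.+ Σℙ f (xs ∖ σ x))              ≡⟨ ℙ.⁻¹-involutive (Σℙ f (xs ∖ σ x)) ⟩
      Σℙ f (xs ∖ σ x)                               ≡⟨ go (xs ∖ σ x) (rec (m<n⇒m<1+n (length-∖ σx∈xs)))
                                                         (unique-∖ uniq) pairs′ ⟩
      0ℙ                                            ∎
      where
      pairs′ : PairsOff f σ (xs ∖ σ x)
      pairs′ {y} y∈ fy with y∈xs , y≢σx ← ∈-∖⁻ y∈ with pairs (there y∈xs) fy
      ... | here σy≡x , _ , _ , σσy≡y = ⊥-elim (y≢σx (trans (sym σσy≡y) (cong σ σy≡x)))
      ... | there σy∈xs , fσy , σy≢y , σσy≡y = ∈-∖⁺ σy∈xs σy≢σx , fσy , σy≢y , σσy≡y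
        where
        σy≢σx : σ y ≢ σ x
        σy≢σx σy≡σx = All.lookup x≢xs y∈xs (trans (sym σσx≡x) (trans (cong σ (sym σy≡σx)) σσy≡y))

-- An index j detecting the odd divisors of o

module OddIndex {n o r : ℕ} (1≤n : 1 ≤ n) (o∣n : o ∣ n) (odd-o : Odd o)
  (r∣o : r ∣ o) (sqf-r : SquareFree r) (o⊴r : o ⊴ r) (sp : Split (2 * o) n) where

  -- j = (o / r) · free, where free is the part of n prime to 2o
  open Split sp

  s = quotient r∣o

  o≡s*r : o ≡ s * r
  o≡s*r = m∣n⇒n≡quotient*m r∣o

  1≤o : 1 ≤ o
  1≤o = 1≤divisor o∣n 1≤n

  free⊥o : Coprime free o
  free⊥o = coprime-∣ʳ free⊥t (n∣m*n 2)

  odd-free : Odd free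
  odd-free = ¬2∣⇒odd free (λ 2∣free → case free⊥t (2∣free , m∣m*n {2} o) of λ ())

  j = s * free

  odd-j : Odd j
  odd-j = odd-* {s} {free} (odd-∣ (quotient-∣ r∣o) odd-o) odd-free

  1≤s : 1 ≤ s
  1≤s = 1≤divisor (quotient-∣ r∣o) 1≤o

  t[o,j]≡r : t o j ≡ r
  t[o,j]≡r = begin
    o ÷ gcd o j                     ≡⟨ cong₂ _÷_ o≡s*r (cong (λ x → gcd x j) o≡s*r) ⟩
    (s * r) ÷ gcd (s * r) (s * free) ≡⟨ cong ((s * r) ÷_) (c*gcd[m,n]≡gcd[cm,cn] s r free) ⟨
    (s * r) ÷ (s * gcd r free)       ≡⟨ cong (λ x → (s * r) ÷ (s * x)) (coprime⇒gcd≡1 (coprime-sym (coprime-∣ʳ free⊥o r∣o))) ⟩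
    (s * r) ÷ (s * 1)                ≡⟨ cong ((s * r) ÷_) (*-identityʳ s) ⟩
    (s * r) ÷ s                      ≡⟨ m*n÷m≡n s r 1≤s ⟩
    r                                ∎

  c[j,o]-odd : parityℤ (c j o) ≡ 1ℙ
  c[j,o]-odd = Equivalence.from (odd-c⇔ j o odd-j 1≤o)
    (subst SquareFree (sym t[o,j]≡r) sqf-r , subst (o ⊴_) (sym t[o,j]≡r) o⊴r)

  module _ {o′} (o′∣n : o′ ∣ n) (odd-o′ : Odd o′) (c[j,o′]-odd : parityℤ (c j o′) ≡ 1ℙ) where

    1≤o′ : 1 ≤ o′
    1≤o′ = 1≤divisor o′∣n 1≤n

    τ = t o′ j
    g = gcd o′ j

    sqf-τ×o′⊴τ : SquareFree τ × o′ ⊴ τ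
    sqf-τ×o′⊴τ = Equivalence.to (odd-c⇔ j o′ odd-j 1≤o′) c[j,o′]-odd

    o′≡g*τ : o′ ≡ g * τ
    o′≡g*τ = m≡gcd*t o′ j 1≤o′

    -- q = gcd o′ free divides g, so τ ∣ o′ / q ∣ part ⊥ free; thus q ⊥ τ, and o′ ⊴ τ forces q = 1
    o′⊥free : Coprime o′ free
    o′⊥free = gcd≡1⇒coprime q≡1
      where
      q = gcd o′ free
      q∣o′ : q ∣ o′
      q∣o′ = gcd[m,n]∣m o′ free
      instance
        q≢0 : NonZero q
        q≢0 = >-nonZero (1≤divisor q∣o′ 1≤o′)
      q∣g : q ∣ g
      q∣g = gcd-greatest q∣o′ (∣-trans (gcd[m,n]∣n o′ free) (n∣m*n s))
      τ∣o′/q : τ ∣ o′ / q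
      τ∣o′/q = m*n∣o⇒n∣o/m q τ (subst (q * τ ∣_) (sym o′≡g*τ) (*-monoˡ-∣ τ q∣g))
      τ⊥free : Coprime τ free
      τ⊥free = coprime-∣ˡ part⊥free (∣-trans τ∣o′/q (m∣n*o⇒m/gcd[m,n]∣o (subst (o′ ∣_) m≡free*part o′∣n)))
      q≡1 : q ≡ 1
      q≡1 = proj₂ sqf-τ×o′⊴τ q (coprime-sym (coprime-∣ʳ τ⊥free (gcd[m,n]∣n o′ free))) (∣-refl , q∣o′)

    o′∣part : o′ ∣ part
    o′∣part = coprime-divisor o′⊥free (subst (o′ ∣_) m≡free*part o′∣n)

    g∣s : g ∣ s
    g∣s = coprime-divisor (coprime-∣ˡ o′⊥free (gcd[m,n]∣m o′ j)) (subst (g ∣_) (*-comm s free) (gcd[m,n]∣n o′ j))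

    τ∣o′ : τ ∣ o′
    τ∣o′ = t∣m o′ j 1≤o′

    τ⊴r : τ ⊴ r
    τ⊴r k k⊥r {e} (e∣k , e∣τ) = part⊴t e e⊥2o (∣-refl , ∣-trans e∣τ (∣-trans τ∣o′ o′∣part))
      where
      e⊥2o : Coprime e (2 * o)
      e⊥2o = coprime-*ʳ (coprime-sym (odd⇒coprime-2 (odd-∣ (∣-trans e∣τ τ∣o′) odd-o′))) (coprime-∣ˡ (o⊴r k k⊥r) e∣k)

    o′∣o : o′ ∣ o
    o′∣o = subst₂ _∣_ (sym o′≡g*τ) (sym o≡s*r) (*-pres-∣ g∣s
      (squareFree-⊴⇒∣ (1≤divisor τ∣o′ 1≤o′) (proj₁ sqf-τ×o′⊴τ) τ⊴r))

  o∣part : o ∣ part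
  o∣part = coprime-divisor (coprime-sym free⊥o) (subst (o ∣_) m≡free*part o∣n)

  1≤part : 1 ≤ part
  1≤part = 1≤divisor (divides free m≡free*part) 1≤n

  j<n : 1 < o ⊎ 2 ∣ n → j < n
  j<n 1<o⊎2∣n with r ≟ 1
  ... | no r≢1 = <-≤-trans (m<m*n j r {{>-nonZero (odd⇒1≤ odd-j)}} 1<r)
    (≤-trans (≤-reflexive j*r≡o*free) (≤-trans (*-monoˡ-≤ free (∣⇒≤ {{>-nonZero 1≤part}} o∣part))
      (≤-reflexive (trans (*-comm part free) (sym m≡free*part)))))
    where
    j*r≡o*free : j * r ≡ o * free
    j*r≡o*free = trans (solve 3 (λ s f r → s :* f :* r := s :* r :* f) refl s free r) (cong (_* free) (sym o≡s*r))
    1<r : 1 < r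
    1<r = ≤∧≢⇒< (1≤divisor r∣o 1≤o) (r≢1 ∘ sym)
  ... | yes r≡1 = subst (_< n) (sym j≡free)
    (subst (free <_) (sym m≡free*part) (m<m*n free part {{>-nonZero (odd⇒1≤ odd-free)}} 2≤part))
    where
    -- r = 1 forces o = 1, and then the alternative 2 ∣ n puts a factor 2 into part
    o≡1 : o ≡ 1
    o≡1 = o⊴r o (subst (Coprime o) (sym r≡1) (coprime-1 o)) (∣-refl , ∣-refl)
    s≡1 : s ≡ 1
    s≡1 = trans (sym (*-identityʳ s)) (trans (cong (s *_) (sym r≡1)) (trans (sym o≡s*r) o≡1))
    j≡free : j ≡ free
    j≡free = trans (cong (_* free) s≡1) (*-identityˡ free)
    2∣n : 2 ∣ n
    2∣n = case 1<o⊎2∣n of λ { (inj₁ 1<o) → ⊥-elim (<⇒≢ 1<o (sym o≡1)) ; (inj₂ 2∣n) → 2∣n }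
    2≤part : 2 ≤ part
    2≤part = ∣⇒≤ {{>-nonZero 1≤part}} (coprime-divisor (odd⇒coprime-2 {free} odd-free) (subst (2 ∣_) m≡free*part 2∣n))

odd-index : ∀ {n o} → 1 ≤ n → o ∣ n → Odd o → 1 < o ⊎ 2 ∣ n →
  ∃ λ j → Odd j × j < n × parityℤ (c j o) ≡ 1ℙ ×
    (∀ {o′} → o′ ∣ n → Odd o′ → parityℤ (c j o′) ≡ 1ℙ → o′ ∣ o)
odd-index {n} {o} 1≤n o∣n odd-o 1<o⊎2∣n with ∃-squareFree-radical o (1≤divisor o∣n 1≤n)
... | r , r∣o , sqf-r , o⊴r = j , odd-j , j<n 1<o⊎2∣n , c[j,o]-odd , o′∣o
  where open OddIndex 1≤n o∣n odd-o r∣o sqf-r o⊴r (split-by (2 * o) n 1≤n)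

-- The divisor set D

open ParitySum _≟_

parityℤ-eigen : ∀ n D j → parityℤ (eigen n D j) ≡ Σℙ (λ d → parityℤ (c j (n ÷ d))) D
parityℤ-eigen n [] j = refl
parityℤ-eigen n (d ∷ D) j =
  trans (parityℤ-+ (c j (n ÷ d)) (eigen n D j)) (cong (parityℤ (c j (n ÷ d)) ℙ.+_) (parityℤ-eigen n D j))

double-or-halve : Parity → Parity → ℕ → ℕ
double-or-halve 0ℙ _ d = 2 * d
double-or-halve 1ℙ 0ℙ d = d ÷ 2
double-or-halve 1ℙ 1ℙ _ = 0

halve-if-even : Parity → ℕ → ℕ
halve-if-even 0ℙ q = q ÷ 2
halve-if-even 1ℙ q = q

module Divisors (n : ℕ) (1≤n : 1 ≤ n) (D : List ℕ) (unique : Unique D)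
  (proper : ∀ d → d ∈ D → d ∣ n × 1 ≤ d × d < n) (4∤n/d : ∀ d → d ∈ D → ¬ 4 ∣ (n ÷ d)) where

  -- d is paired with 2d when n/d is even and with d/2 when n/d is odd; since 0 ∉ D,
  -- the value 0 marks a d which has no partner because d and n/d are both odd
  partner : ℕ → ℕ
  partner d = double-or-halve (parity (n ÷ d)) (parity d) d

  oddPart : ℕ → ℕ
  oddPart d = halve-if-even (parity (n ÷ d)) (n ÷ d)

  1≤d : ∀ {d} → d ∈ D → 1 ≤ d
  1≤d {d} d∈D = proj₁ (proj₂ (proper d d∈D))

  0∉D : 0 ∉ D
  0∉D 0∈D = case 1≤d 0∈D of λ ()

  n≡n÷d*d : ∀ {d} → d ∈ D → n ≡ (n ÷ d) * d
  n≡n÷d*d {zero} 0∈D = ⊥-elim (0∉D 0∈D)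
  n≡n÷d*d {suc _} d∈D = sym (m/n*n≡m (proj₁ (proper _ d∈D)))

  n÷-cancel : ∀ {a x} → n ≡ a * x → 1 ≤ x → n ÷ x ≡ a
  n÷-cancel {a} {x} n≡a*x 1≤x = trans (cong (_÷ x) n≡a*x) (m*n÷n≡m a x 1≤x)

  n÷d∣n : ∀ {d} → d ∈ D → n ÷ d ∣ n
  n÷d∣n {d} d∈D = divides d (trans (n≡n÷d*d d∈D) (*-comm (n ÷ d) d))

  1≤n÷d : ∀ {d} → d ∈ D → 1 ≤ n ÷ d
  1≤n÷d d∈D = 1≤divisor (n÷d∣n d∈D) 1≤n

  quotients-related : ∀ {d d′} k → d ∈ D → d′ ∈ D → n ÷ d′ ≡ k * (n ÷ d) → d ≡ k * d′
  quotients-related {d} {d′} k d∈D d′∈D n÷d′≡ = *-cancelˡ-≡ d (k * d′) (n ÷ d) {{>-nonZero (1≤n÷d d∈D)}} (begin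
    n ÷ d * d             ≡⟨ n≡n÷d*d d∈D ⟨
    n                     ≡⟨ n≡n÷d*d d′∈D ⟩
    n ÷ d′ * d′           ≡⟨ cong (_* d′) n÷d′≡ ⟩
    k * (n ÷ d) * d′      ≡⟨ solve 3 (λ k q d → k :* q :* d := q :* (k :* d)) refl k (n ÷ d) d′ ⟩
    n ÷ d * (k * d′)      ∎)

  data Shape (d : ℕ) : Set where
    odd-quotient : Odd (n ÷ d) → Shape d
    twice-odd : ∀ o → n ÷ d ≡ 2 * o → Odd o → Shape d

  shape : ∀ {d} → d ∈ D → Shape d
  shape {d} d∈D with parity (n ÷ d) in p
  ... | 1ℙ = odd-quotient p
  ... | 0ℙ with divides o n÷d≡o*2 ← parity≡0ℙ⇒2∣ (n ÷ d) p with parity o in po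
  ...   | 1ℙ = twice-odd o (trans n÷d≡o*2 (*-comm o 2)) po
  ...   | 0ℙ = ⊥-elim (4∤n/d d d∈D (subst (4 ∣_) (sym n÷d≡o*2) (*-monoˡ-∣ 2 (parity≡0ℙ⇒2∣ o po))))

  partner-of-twice-odd : ∀ d o → n ÷ d ≡ 2 * o → partner d ≡ 2 * d
  partner-of-twice-odd d o n÷d≡2o =
    cong (λ p → double-or-halve p (parity d) d) (trans (cong parity n÷d≡2o) (parity[2*n] o))

  oddPart-of-twice-odd : ∀ d o → n ÷ d ≡ 2 * o → oddPart d ≡ o
  oddPart-of-twice-odd d o n÷d≡2o = begin
    halve-if-even (parity (n ÷ d)) (n ÷ d)  ≡⟨ cong (λ p → halve-if-even p (n ÷ d)) (trans (cong parity n÷d≡2o) (parity[2*n] o)) ⟩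
    (n ÷ d) ÷ 2                             ≡⟨ cong (_÷ 2) n÷d≡2o ⟩
    (2 * o) ÷ 2                             ≡⟨ m*n÷m≡n 2 o (s≤s z≤n) ⟩
    o                                       ∎

  partner-of-odd-quotient : ∀ d h → Odd (n ÷ d) → d ≡ 2 * h → partner d ≡ h
  partner-of-odd-quotient d h odd-q d≡2h = begin
    double-or-halve (parity (n ÷ d)) (parity d) d ≡⟨ cong₂ (λ p p′ → double-or-halve p p′ d) odd-q
                                                       (trans (cong parity d≡2h) (parity[2*n] h)) ⟩
    d ÷ 2                                         ≡⟨ cong (_÷ 2) d≡2h ⟩
    (2 * h) ÷ 2                                   ≡⟨ m*n÷m≡n 2 h (s≤s z≤n) ⟩
    h                                             ∎

  partner-of-odd : ∀ d → Odd (n ÷ d) → Odd d → partner d ≡ 0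
  partner-of-odd d odd-q odd-d = cong₂ (λ p p′ → double-or-halve p p′ d) odd-q odd-d

  oddPart-of-odd-quotient : ∀ d → Odd (n ÷ d) → oddPart d ≡ n ÷ d
  oddPart-of-odd-quotient d odd-q = cong (λ p → halve-if-even p (n ÷ d)) odd-q

  n÷[2*d]≡ : ∀ {d} o → d ∈ D → n ÷ d ≡ 2 * o → n ÷ (2 * d) ≡ o
  n÷[2*d]≡ {d} o d∈D n÷d≡2o = n÷-cancel (trans (n≡n÷d*d d∈D)
    (trans (cong (_* d) n÷d≡2o) (solve 2 (λ o d → con 2 :* o :* d := o :* (con 2 :* d)) refl o d)))
    (≤-trans (1≤d d∈D) (m≤m+n d _))

  n÷h≡ : ∀ {d} h → d ∈ D → d ≡ 2 * h → n ÷ h ≡ 2 * (n ÷ d)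
  n÷h≡ {d} h d∈D d≡2h = n÷-cancel (trans (n≡n÷d*d d∈D)
    (trans (cong (n ÷ d *_) d≡2h) (solve 2 (λ q h → q :* (con 2 :* h) := con 2 :* q :* h) refl (n ÷ d) h)))
    (n≢0⇒n>0 (λ { refl → <⇒≢ (1≤d d∈D) (sym d≡2h) }))

  odd-oddPart : ∀ {d} → d ∈ D → Odd (oddPart d)
  odd-oddPart {d} d∈D with shape d∈D
  ... | odd-quotient odd-q = subst Odd (sym (oddPart-of-odd-quotient d odd-q)) odd-q
  ... | twice-odd o n÷d≡2o odd-o = subst Odd (sym (oddPart-of-twice-odd d o n÷d≡2o)) odd-o

  oddPart∣n : ∀ {d} → d ∈ D → oddPart d ∣ n
  oddPart∣n {d} d∈D with shape d∈D
  ... | odd-quotient odd-q = subst (_∣ n) (sym (oddPart-of-odd-quotient d odd-q)) (n÷d∣n d∈D)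
  ... | twice-odd o n÷d≡2o _ = subst (_∣ n) (sym (oddPart-of-twice-odd d o n÷d≡2o))
    (∣-trans (divides 2 n÷d≡2o) (n÷d∣n d∈D))

  c-oddPart : ∀ {j d} → Odd j → d ∈ D → parityℤ (c j (n ÷ d)) ≡ parityℤ (c j (oddPart d))
  c-oddPart {j} {d} odd-j d∈D with shape d∈D
  ... | odd-quotient odd-q = cong (parityℤ ∘ c j) (sym (oddPart-of-odd-quotient d odd-q))
  ... | twice-odd o n÷d≡2o odd-o = begin
    parityℤ (c j (n ÷ d))        ≡⟨ cong (parityℤ ∘ c j) n÷d≡2o ⟩
    parityℤ (c j (2 * o))        ≡⟨ c[2*o]-parity j o odd-j odd-o ⟩
    parityℤ (c j o)              ≡⟨ cong (parityℤ ∘ c j) (oddPart-of-twice-odd d o n÷d≡2o) ⟨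
    parityℤ (c j (oddPart d))    ∎

  record Partners (d : ℕ) : Set where
    field
      partner-involutive : partner (partner d) ≡ d
      partner-≢ : partner d ≢ d
      oddPart-partner : oddPart (partner d) ≡ oddPart d

  partners : ∀ {d} → d ∈ D → partner d ∈ D → Partners d
  partners {d} d∈D p∈D with shape d∈D
  ... | twice-odd o n÷d≡2o odd-o = record
    { partner-involutive = trans (cong partner p≡2d) (partner-of-odd-quotient (2 * d) d odd-n÷2d refl)
    ; partner-≢ = λ p≡d → d≢2*d (1≤d d∈D) (trans (sym p≡d) p≡2d)
    ; oddPart-partner = begin
        oddPart (partner d)   ≡⟨ cong oddPart p≡2d ⟩
        oddPart (2 * d)       ≡⟨ oddPart-of-odd-quotient (2 * d) odd-n÷2d ⟩
        n ÷ (2 * d)           ≡⟨ n÷[2*d]≡ o d∈D n÷d≡2o ⟩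
        o                     ≡⟨ oddPart-of-twice-odd d o n÷d≡2o ⟨
        oddPart d             ∎
    }
    where
    p≡2d : partner d ≡ 2 * d
    p≡2d = partner-of-twice-odd d o n÷d≡2o
    odd-n÷2d : Odd (n ÷ (2 * d))
    odd-n÷2d = subst Odd (sym (n÷[2*d]≡ o d∈D n÷d≡2o)) odd-o
  ... | odd-quotient odd-q with 2 ∣? d
  ...   | no 2∤d = ⊥-elim (0∉D (subst (_∈ D) (partner-of-odd d odd-q (¬2∣⇒odd d 2∤d)) p∈D))
  ...   | yes (divides h d≡h*2) = record
    { partner-involutive = trans (cong partner p≡h) (trans (partner-of-twice-odd h (n ÷ d) n÷h≡2q) (sym d≡2h))
    ; partner-≢ = λ p≡d → d≢2*d 1≤h (trans (trans (sym p≡h) p≡d) d≡2h)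
    ; oddPart-partner = begin
        oddPart (partner d)   ≡⟨ cong oddPart p≡h ⟩
        oddPart h             ≡⟨ oddPart-of-twice-odd h (n ÷ d) n÷h≡2q ⟩
        n ÷ d                 ≡⟨ oddPart-of-odd-quotient d odd-q ⟨
        oddPart d             ∎
    }
    where
    d≡2h : d ≡ 2 * h
    d≡2h = trans d≡h*2 (*-comm h 2)
    p≡h : partner d ≡ h
    p≡h = partner-of-odd-quotient d h odd-q d≡2h
    n÷h≡2q : n ÷ h ≡ 2 * (n ÷ d)
    n÷h≡2q = n÷h≡ h d∈D d≡2h
    1≤h : 1 ≤ h
    1≤h = n≢0⇒n>0 (λ h≡0 → <⇒≢ (1≤d d∈D) (sym (trans d≡2h (cong (2 *_) h≡0))))

  same-oddPart : ∀ {d d′} → d ∈ D → d′ ∈ D → oddPart d ≡ oddPart d′ → d ≡ d′ ⊎ partner d ≡ d′ ⊎ partner d′ ≡ d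
  same-oddPart {d} {d′} d∈D d′∈D eq with shape d∈D | shape d′∈D
  ... | odd-quotient oq | odd-quotient oq′ = inj₁ (trans (quotients-related 1 d∈D d′∈D (begin
    n ÷ d′          ≡⟨ oddPart-of-odd-quotient d′ oq′ ⟨
    oddPart d′      ≡⟨ eq ⟨
    oddPart d       ≡⟨ oddPart-of-odd-quotient d oq ⟩
    n ÷ d           ≡⟨ *-identityˡ (n ÷ d) ⟨
    1 * (n ÷ d)     ∎)) (*-identityˡ d′))
  ... | twice-odd o e _ | twice-odd o′ e′ _ = inj₁ (trans (quotients-related 1 d∈D d′∈D (begin
    n ÷ d′          ≡⟨ e′ ⟩
    2 * o′          ≡⟨ cong (2 *_) (trans (sym (oddPart-of-twice-odd d′ o′ e′)) (trans (sym eq) (oddPart-of-twice-odd d o e))) ⟩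
    2 * o           ≡⟨ e ⟨
    n ÷ d           ≡⟨ *-identityˡ (n ÷ d) ⟨
    1 * (n ÷ d)     ∎)) (*-identityˡ d′))
  ... | odd-quotient oq | twice-odd o′ e′ _ = inj₂ (inj₂ (trans (partner-of-twice-odd d′ o′ e′)
    (sym (quotients-related 2 d∈D d′∈D (trans e′ (cong (2 *_) o′≡n÷d))))))
    where
    o′≡n÷d : o′ ≡ n ÷ d
    o′≡n÷d = trans (sym (oddPart-of-twice-odd d′ o′ e′)) (trans (sym eq) (oddPart-of-odd-quotient d oq))
  ... | twice-odd o e _ | odd-quotient oq′ = inj₂ (inj₁ (trans (partner-of-twice-odd d o e)
    (sym (quotients-related 2 d′∈D d∈D (trans e (cong (2 *_) o≡n÷d′))))))
    where
    o≡n÷d′ : o ≡ n ÷ d′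
    o≡n÷d′ = trans (sym (oddPart-of-twice-odd d o e)) (trans eq (oddPart-of-odd-quotient d′ oq′))

  c-partner : ∀ {j d} → Odd j → d ∈ D → partner d ∈ D → parityℤ (c j (n ÷ partner d)) ≡ parityℤ (c j (n ÷ d))
  c-partner {j} {d} odd-j d∈D p∈D = begin
    parityℤ (c j (n ÷ partner d))    ≡⟨ c-oddPart odd-j p∈D ⟩
    parityℤ (c j (oddPart (partner d))) ≡⟨ cong (parityℤ ∘ c j) (Partners.oddPart-partner (partners d∈D p∈D)) ⟩
    parityℤ (c j (oddPart d))        ≡⟨ c-oddPart odd-j d∈D ⟨
    parityℤ (c j (n ÷ d))            ∎

  Closed : Set
  Closed = ∀ {d} → d ∈ D → partner d ∈ D

  closed⇒D₁∪2D₁ : Closed → ∀ x → (x ∈ D) ⇔ InD₁∪2D₁ n D x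
  closed⇒D₁∪2D₁ closed x = mk⇔ to from
    where
    to : x ∈ D → InD₁∪2D₁ n D x
    to x∈D with shape x∈D
    ... | twice-odd o e odd-o = inj₁ (x∈D , subst (λ q → q % 4 ≡ 2) (sym e) (2*odd%4≡2 o odd-o))
    ... | odd-quotient oq with 2 ∣? x
    ...   | no 2∤x = ⊥-elim (0∉D (subst (_∈ D) (partner-of-odd x oq (¬2∣⇒odd x 2∤x)) (closed x∈D)))
    ...   | yes (divides h x≡h*2) =
      inj₂ (h , (h∈D , subst (λ q → q % 4 ≡ 2) (sym (n÷h≡ h x∈D x≡2h)) (2*odd%4≡2 (n ÷ x) oq)) , x≡2h)
      where
      x≡2h : x ≡ 2 * h
      x≡2h = trans x≡h*2 (*-comm h 2)
      h∈D : h ∈ D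
      h∈D = subst (_∈ D) (partner-of-odd-quotient x h oq x≡2h) (closed x∈D)
    from : InD₁∪2D₁ n D x → x ∈ D
    from (inj₁ (x∈D , _)) = x∈D
    from (inj₂ (d , (d∈D , q%4≡2) , x≡2d)) with shape d∈D
    ... | odd-quotient oq = ⊥-elim (case trans (sym oq) (%4≡2⇒parity≡0ℙ (n ÷ d) q%4≡2) of λ ())
    ... | twice-odd o e _ = subst (_∈ D) (trans (partner-of-twice-odd d o e) (sym x≡2d)) (closed d∈D)

  D₁∪2D₁⇒closed : (∀ x → (x ∈ D) ⇔ InD₁∪2D₁ n D x) → Closed
  D₁∪2D₁⇒closed D≡ {d} d∈D with shape d∈D
  ... | twice-odd o e odd-o = subst (_∈ D) (sym (partner-of-twice-odd d o e))
    (Equivalence.from (D≡ (2 * d)) (inj₂ (d , (d∈D , subst (λ q → q % 4 ≡ 2) (sym e) (2*odd%4≡2 o odd-o)) , refl)))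
  ... | odd-quotient oq with Equivalence.to (D≡ d) d∈D
  ...   | inj₁ (_ , q%4≡2) = ⊥-elim (case trans (sym oq) (%4≡2⇒parity≡0ℙ (n ÷ d) q%4≡2) of λ ())
  ...   | inj₂ (h , (h∈D , _) , d≡2h) = subst (_∈ D) (sym (partner-of-odd-quotient d h oq d≡2h)) h∈D

  closed⇒even : Closed → ∀ {j} → Odd j → parityℤ (eigen n D j) ≡ 0ℙ
  closed⇒even closed {j} odd-j = trans (parityℤ-eigen n D j) (Σℙ-pairedOff _ partner D unique pairs)
    where
    pairs : PairsOff (λ d → parityℤ (c j (n ÷ d))) partner D
    pairs d∈D odd-c = closed d∈D , trans (c-partner odd-j d∈D (closed d∈D)) odd-c , partner-≢ , partner-involutive
      where open Partners (partners d∈D (closed d∈D))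

  1<oddPart⊎2∣n : ∀ {d} → d ∈ D → 1 < oddPart d ⊎ 2 ∣ n
  1<oddPart⊎2∣n {d} d∈D with shape d∈D
  ... | twice-odd o e _ = inj₂ (∣-trans (divides o (trans e (*-comm 2 o))) (n÷d∣n d∈D))
  ... | odd-quotient oq = inj₁ (subst (1 <_) (sym (oddPart-of-odd-quotient d oq))
    (≤∧≢⇒< (1≤n÷d d∈D) (λ 1≡n÷d → <⇒≢ (proj₂ (proj₂ (proper d d∈D)))
      (sym (trans (n≡n÷d*d d∈D) (trans (cong (_* d) (sym 1≡n÷d)) (*-identityˡ d)))))))

  module Unpaired {ds} (ds∈D : ds ∈ D) (ds-unpaired : partner ds ∉ D)
    (minimal : ∀ {y} → y ∈ D → partner y ∉ D → oddPart ds ≤ oddPart y)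
    {j} (odd-j : Odd j) (c[j,o]-odd : parityℤ (c j (oddPart ds)) ≡ 1ℙ)
    (only-divisors : ∀ {o′} → o′ ∣ n → Odd o′ → parityℤ (c j o′) ≡ 1ℙ → o′ ∣ oddPart ds) where

    P : ℕ → Parity
    P d = parityℤ (c j (n ÷ d))

    -- an unpaired y with P y odd has oddPart y ∣ oddPart ds, hence by minimality the same odd part
    paired : ∀ {y} → y ∈ D → y ≢ ds → P y ≡ 1ℙ → partner y ∈ D
    paired {y} y∈D y≢ds Py with partner y ∈? D
    ... | yes p∈D = p∈D
    ... | no y-unpaired with same-oddPart y∈D ds∈D (≤-antisym oddPart-y≤ (minimal y∈D y-unpaired))
      where
      oddPart-y≤ : oddPart y ≤ oddPart ds
      oddPart-y≤ = ∣⇒≤ {{>-nonZero (odd⇒1≤ (odd-oddPart ds∈D))}}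
        (only-divisors (oddPart∣n y∈D) (odd-oddPart y∈D) (trans (sym (c-oddPart odd-j y∈D)) Py))
    ...   | inj₁ y≡ds = ⊥-elim (y≢ds y≡ds)
    ...   | inj₂ (inj₁ p≡ds) = ⊥-elim (y-unpaired (subst (_∈ D) (sym p≡ds) ds∈D))
    ...   | inj₂ (inj₂ p≡y) = ⊥-elim (ds-unpaired (subst (_∈ D) (sym p≡y) y∈D))

    pairs : PairsOff P partner (D ∖ ds)
    pairs {y} y∈ Py = ∈-∖⁺ p∈D p≢ds , trans (c-partner odd-j y∈D p∈D) Py , partner-≢ , partner-involutive
      where
      y∈D = proj₁ (∈-∖⁻ {xs = D} y∈)
      p∈D = paired y∈D (proj₂ (∈-∖⁻ {xs = D} y∈)) Py
      open Partners (partners y∈D p∈D)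
      p≢ds : partner y ≢ ds
      p≢ds p≡ds = ds-unpaired (subst (_∈ D) (trans (sym partner-involutive) (cong partner p≡ds)) y∈D)

    odd-eigenvalue : parityℤ (eigen n D j) ≡ 1ℙ
    odd-eigenvalue = begin
      parityℤ (eigen n D j)       ≡⟨ parityℤ-eigen n D j ⟩
      Σℙ P D                      ≡⟨ Σℙ-∖ P D unique ds∈D ⟩
      P ds ℙ.+ Σℙ P (D ∖ ds)      ≡⟨ cong₂ ℙ._+_ (trans (c-oddPart odd-j ds∈D) c[j,o]-odd)
                                       (Σℙ-pairedOff P partner (D ∖ ds) (unique-∖ unique) pairs) ⟩
      1ℙ ℙ.+ 0ℙ                   ≡⟨⟩
      1ℙ                          ∎

  unpaired⇒odd-eigenvalue : ∀ {d} → d ∈ D → partner d ∉ D → ∃ λ j → j < n × Odd j × parityℤ (eigen n D j) ≡ 1ℙ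
  unpaired⇒odd-eigenvalue d∈D unpaired =
    let ds , ds∈D , ds-unpaired , minimal = ∃-minimal (λ d → ¬? (partner d ∈? D)) oddPart D d∈D unpaired
        j , odd-j , j<n , c[j,o]-odd , only-divisors =
          odd-index 1≤n (oddPart∣n ds∈D) (odd-oddPart ds∈D) (1<oddPart⊎2∣n ds∈D)
    in j , j<n , odd-j , Unpaired.odd-eigenvalue ds∈D ds-unpaired minimal odd-j c[j,o]-odd only-divisors

  even⇒closed : (∀ {j} → j < n → Odd j → parityℤ (eigen n D j) ≡ 0ℙ) → Closed
  even⇒closed all-even {d} d∈D with partner d ∈? D
  ... | yes p∈D = p∈D
  ... | no unpaired = ⊥-elim (no-odd-eigenvalue (unpaired⇒odd-eigenvalue d∈D unpaired))
    where
    no-odd-eigenvalue : ¬ (∃ λ j → j < n × Odd j × parityℤ (eigen n D j) ≡ 1ℙ)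
    no-odd-eigenvalue (j , j<n , odd-j , odd-eigen) with () ← trans (sym (all-even j<n odd-j)) odd-eigen

mainTheorem9 : (n : ℕ) → 2 ≤ n → (D : List ℕ) → Unique D →
    (∀ d → d ∈ D → d ∣ n × 1 ≤ d × d < n) →
    (∀ d → d ∈ D → ¬ (4 ∣ (n ÷ d))) →
    ((∀ j → j < n → j % 2 ≡ 1 → (+ 2) ∣ℤ eigen n D j)
    ⇔ (∀ x → (x ∈ D) ⇔ InD₁∪2D₁ n D x))
mainTheorem9 n 2≤n D unique proper 4∤n/d = mk⇔
  (λ all-even → closed⇒D₁∪2D₁ (even⇒closed (λ {j} j<n odd-j →
    2∣⇒parity≡0ℙ (all-even j j<n (Equivalence.from (%2≡1⇔odd j) odd-j)))))
  (λ D≡ j j<n j%2≡1 → parity≡0ℙ⇒2∣ _ (closed⇒even (D₁∪2D₁⇒closed D≡) (Equivalence.to (%2≡1⇔odd j) j%2≡1)))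
  where open Divisors n (≤-trans (s≤s z≤n) 2≤n) D unique proper 4∤n/d
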